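{- Let $\mathfrak{f}_n=\mathfrak{d}^e_n-\mathfrak{d}^o_n$, where $\mathfrak{d}^e_n$ and $\mathfrak{d}^o_n$ are the numbers of even and odd parity alternating derangements (PADs) of $[n]$ (with $\mathfrak{f}_0=1$). Then \[ \sum_{n\ge 0}\mathfrak{f}_n\frac{x^n}{n!}=\frac{e^x}{8}+\frac{e^{ -x}}{8}\left(2x^2+6x+7\right). \]
   Context: A permutation $\sigma$ of $[n]=\{1,\dots,n\}$, in one-line notation, is a PAP if $\sigma(i)\equiv i\pmod 2$ for all $i$ (entries alternate in parity, first entry odd); a PAD is a PAP that is a derangement ($\sigma(i)\neq i$ for all $i$). A permutation is even or odd according to its sign $(-1)^{n-c}$, with $c$ its number of cycles (fixed points included). The empty permutation is an even PAD. -}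

module Defs where

open import Data.Nat as ℕ using (ℕ; zero; suc; _∸_; _%_; _≤?_)
open import Data.Nat.Combinatorics using (_C_)
open import Data.Fin using (Fin; toℕ; zero; suc)
open import Data.Fin.Properties using (all?; _≟_)
open import Data.Vec using (Vec; []; _∷_; lookup)
open import Data.List using (List; []; _∷_; [_]; map; concatMap; filter; length; foldr; upTo; allFin)
open import Data.Integer as ℤ using (ℤ; +_)
open import Data.Rational as ℚ using (ℚ; _/_; 0ℚ; 1ℚ)
open import Relation.Binary.PropositionalEquality using (_≡_; _≢_)
open import Relation.Nullary using (Dec; ¬_; ¬?)
open import Relation.Nullary.Decidable using (_×-dec_; _→-dec_)
open import Data.Product using (_×_)

-- Permutations of [n] in one-line notation.
-- A word v : Vec (Fin n) n encodes σ(i+1) = 1 + toℕ (lookup v i)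
-- (Fin n = {0,…,n-1} is identified with [n] = {1,…,n} by adding 1).

allWords : (m n : ℕ) → List (Vec (Fin n) m)
allWords zero    n = [ [] ]
allWords (suc m) n = concatMap (λ i → map (i ∷_) (allWords m n)) (allFin n)

module _ {n : ℕ} (v : Vec (Fin n) n) where

  σ : Fin n → Fin n
  σ i = lookup v i

  -- v is a permutation (injective, hence bijective on Fin n)
  IsPerm : Set
  IsPerm = ∀ i j → σ i ≡ σ j → i ≡ j

  isPerm? : Dec IsPerm
  isPerm? = all? λ i → all? λ j → (σ i ≟ σ j) →-dec (i ≟ j)

  -- σ(i) ≡ i (mod 2) for all i  (shift by 1 does not change this)
  ParityAlt : Set
  ParityAlt = ∀ i → toℕ (σ i) % 2 ≡ toℕ i % 2

  parityAlt? : Dec ParityAlt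
  parityAlt? = all? λ i → toℕ (σ i) % 2 ℕ.≟ toℕ i % 2

  Derangement : Set
  Derangement = ∀ i → σ i ≢ i

  derangement? : Dec Derangement
  derangement? = all? λ i → ¬? (σ i ≟ i)

  IsPAD : Set
  IsPAD = IsPerm × ParityAlt × Derangement

  isPAD? : Dec IsPAD
  isPAD? = isPerm? ×-dec parityAlt? ×-dec derangement?

  iter : ℕ → Fin n → Fin n
  iter zero    i = i
  iter (suc k) i = σ (iter k i)

  -- i is the least element of its cycle: i ≤ σ^k(i) for k = 0,…,n-1
  -- (every orbit has length ≤ n, so this scans the whole cycle)
  CycleMin : Fin n → Set
  CycleMin i = ∀ (k : Fin n) → toℕ i ℕ.≤ toℕ (iter (toℕ k) i)

  cycleMin? : (i : Fin n) → Dec (CycleMin i)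
  cycleMin? i = all? λ k → toℕ i ≤? toℕ (iter (toℕ k) i)

  -- number of cycles (fixed points included) = number of cycle minima
  cycles : ℕ
  cycles = length (filter cycleMin? (allFin n))

  -- σ is even iff its sign (-1)^(n - c) is +1
  IsEven : Set
  IsEven = (n ∸ cycles) % 2 ≡ 0

  isEven? : Dec IsEven
  isEven? = ((n ∸ cycles) % 2) ℕ.≟ 0

  EvenPAD : Set
  EvenPAD = IsPAD × IsEven

  evenPAD? : Dec EvenPAD
  evenPAD? = isPAD? ×-dec isEven?

  OddPAD : Set
  OddPAD = IsPAD × ¬ IsEven

  oddPAD? : Dec OddPAD
  oddPAD? = isPAD? ×-dec ¬? isEven?

dE : ℕ → ℕ
dE n = length (filter (evenPAD? {n}) (allWords n n))

dO : ℕ → ℕ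
dO n = length (filter (oddPAD? {n}) (allWords n n))

𝔣 : ℕ → ℤ
𝔣 n = + dE n ℤ.- + dO n

-- Formal exponential generating functions over ℚ:
-- A : EGF represents the formal series Σ_n A n · xⁿ / n!.

EGF : Set
EGF = ℕ → ℚ

ℤtoℚ : ℤ → ℚ
ℤtoℚ z = z / 1

ℕtoℚ : ℕ → ℚ
ℕtoℚ m = + m / 1

_⊕_ : EGF → EGF → EGF
(A ⊕ B) n = A n ℚ.+ B n

_·_ : ℚ → EGF → EGF
(c · A) n = c ℚ.* A n

-- product of formal series, in EGF coefficients (binomial convolution)
_⊛_ : EGF → EGF → EGF
(A ⊛ B) n = foldr ℚ._+_ 0ℚ
  (map (λ k → ℕtoℚ (n C k) ℚ.* (A k ℚ.* B (n ∸ k))) (upTo (suc n)))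

egf : (ℕ → ℤ) → EGF
egf a n = ℤtoℚ (a n)

expX : EGF
expX n = 1ℚ

expNegX : EGF
expNegX zero    = 1ℚ
expNegX (suc n) = ℚ.- expNegX n

-- a polynomial Σ c_n xⁿ (ordinary coefficients) as an EGF: n! · c_n
poly : List ℚ → EGF
poly cs n = ℕtoℚ (n ℕ.!) ℚ.* coeff cs n
  where
  coeff : List ℚ → ℕ → ℚ
  coeff []       _       = 0ℚ
  coeff (c ∷ cs) zero    = c
  coeff (c ∷ cs) (suc k) = coeff cs k

rhs : EGF
rhs = ((+ 1 / 8) · expX)
    ⊕ ((+ 1 / 8) · (expNegX ⊛ poly (ℤtoℚ (+ 7) ∷ ℤtoℚ (+ 6) ∷ ℤtoℚ (+ 2) ∷ [])))

{-# OPTIONS --safe #-}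
-- A parity-alternating permutation (PAP) of [n] permutes the a = ⌈n/2⌉ odd positions and the
-- b = ⌊n/2⌋ even positions separately, and its sign and fixed points split accordingly.
-- Inclusion–exclusion over the fixed points of each class writes 𝔣ₙ through the signed sums
-- Σ_v sgn v · C(fix₀ v, r₀) · C(fix₁ v, r₁) over PAPs v; inserting the largest point n (as a new
-- fixed point, or right after a point of its own parity class) shows that these factor as
-- Φ a r₀ · Φ b r₁, the corresponding signed sums over all permutations of an a-set and a b-set.
-- Hence 𝔣ₙ = ψ a · ψ b, with ψ s = (-1)^(s-1) (s - 1) the signed derangement count of an s-set,
-- and this is the n-th coefficient (1 + (-1)ⁿ (2n² - 8n + 7)) / 8 of the right-hand side.
module Submission where

open import Defs
open import Data.Nat using (ℕ)
open import Relation.Binary.PropositionalEquality using (_≡_)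

module IndicatorSums where

  open import Data.Nat as ℕ using (ℕ; zero; suc)
  open import Data.Integer as ℤ using (ℤ; +_; 0ℤ; 1ℤ; _+_; _*_; -_; _-_)
  open import Data.Integer.Properties hiding (_≟_)
  open import Data.Integer.Tactic.RingSolver
  open import Data.Fin as Fin using (Fin; zero; suc; inject₁; fromℕ)
  open import Data.Fin.Properties using (_≟_; suc-injective)
  open import Data.List using (List; []; _∷_; map; concatMap; filter; length; _++_; tabulate; allFin)
  open import Data.Maybe using (Maybe; just; nothing)
  import Data.Maybe.Properties as MaybeP
  open import Data.Product using (_×_; proj₁; proj₂)
  open import Data.Vec as Vec using (Vec; []; _∷_)
  import Data.Vec.Properties as VecP
  open import Data.Vec.Properties using (∷-injective)
  open import Function using (_∘_)
  open import Relation.Binary.PropositionalEquality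
  open import Relation.Nullary
  open import Relation.Unary using (Decidable)

  ∑ : ∀ {a} {A : Set a} → List A → (A → ℤ) → ℤ
  ∑ [] f = 0ℤ
  ∑ (x ∷ xs) f = f x + ∑ xs f

  module _ {a} {A : Set a} where
    ∑-cong : (xs : List A) {f g : A → ℤ} → (∀ x → f x ≡ g x) → ∑ xs f ≡ ∑ xs g
    ∑-cong [] e = refl
    ∑-cong (x ∷ xs) e = cong₂ _+_ (e x) (∑-cong xs e)

    ∑-+ : (xs : List A) (f g : A → ℤ) → ∑ xs (λ x → f x + g x) ≡ ∑ xs f + ∑ xs g
    ∑-+ [] f g = refl
    ∑-+ (x ∷ xs) f g rewrite ∑-+ xs f g = by-ring (f x) (g x) (∑ xs f) (∑ xs g)
      where by-ring : ∀ a b c d → (a + b) + (c + d) ≡ (a + c) + (b + d)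
            by-ring = solve-∀

    ∑-* : (xs : List A) (c : ℤ) (f : A → ℤ) → ∑ xs (λ x → c * f x) ≡ c * ∑ xs f
    ∑-* [] c f = sym (*-zeroʳ c)
    ∑-* (x ∷ xs) c f rewrite ∑-* xs c f = sym (*-distribˡ-+ c (f x) (∑ xs f))

    ∑-0 : (xs : List A) → ∑ xs (λ _ → 0ℤ) ≡ 0ℤ
    ∑-0 [] = refl
    ∑-0 (x ∷ xs) = trans (+-identityˡ _) (∑-0 xs)

    ∑-neg : (xs : List A) (f : A → ℤ) → ∑ xs (λ x → - f x) ≡ - ∑ xs f
    ∑-neg [] f = refl
    ∑-neg (x ∷ xs) f rewrite ∑-neg xs f = sym (neg-distrib-+ (f x) (∑ xs f))

    ∑-++ : (xs ys : List A) (f : A → ℤ) → ∑ (xs ++ ys) f ≡ ∑ xs f + ∑ ys f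
    ∑-++ [] ys f = sym (+-identityˡ _)
    ∑-++ (x ∷ xs) ys f rewrite ∑-++ xs ys f = sym (+-assoc (f x) (∑ xs f) (∑ ys f))

  module _ {a b} {A : Set a} {B : Set b} where
    ∑-map : (g : A → B) (xs : List A) (f : B → ℤ) → ∑ (map g xs) f ≡ ∑ xs (f ∘ g)
    ∑-map g [] f = refl
    ∑-map g (x ∷ xs) f = cong (λ z → f (g x) + z) (∑-map g xs f)

    ∑-concatMap : (g : A → List B) (xs : List A) (f : B → ℤ) →
      ∑ (concatMap g xs) f ≡ ∑ xs (λ x → ∑ (g x) f)
    ∑-concatMap g [] f = refl
    ∑-concatMap g (x ∷ xs) f = trans (∑-++ (g x) (concatMap g xs) f) (cong (λ z → ∑ (g x) f + z) (∑-concatMap g xs f))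

    ∑-swap : (xs : List A) (ys : List B) (f : A → B → ℤ) →
      ∑ xs (λ x → ∑ ys (λ y → f x y)) ≡ ∑ ys (λ y → ∑ xs (λ x → f x y))
    ∑-swap [] ys f = sym (∑-0 ys)
    ∑-swap (x ∷ xs) ys f rewrite ∑-swap xs ys f = sym (∑-+ ys (λ y → f x y) (λ y → ∑ xs (λ x → f x y)))

  ∑-*ʳ : ∀ {a} {A : Set a} (xs : List A) (f : A → ℤ) (c : ℤ) → ∑ xs f * c ≡ ∑ xs (λ x → f x * c)
  ∑-*ʳ xs f c = trans (*-comm (∑ xs f) c) (trans (sym (∑-* xs c f)) (∑-cong xs (λ x → *-comm c (f x))))

  ∑*∑ : ∀ {a b} {A : Set a} {B : Set b} (xs : List A) (ys : List B) f g → ∑ xs f * ∑ ys g ≡ ∑ xs (λ x → ∑ ys (λ y → f x * g y))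
  ∑*∑ xs ys f g = trans (∑-*ʳ xs f (∑ ys g)) (∑-cong xs (λ x → sym (∑-* ys (f x) g)))

  ⟦_⟧ : ∀ {p} {P : Set p} → Dec P → ℤ
  ⟦ yes _ ⟧ = 1ℤ
  ⟦ no _ ⟧ = 0ℤ

  ⟦⟧-iff : ∀ {p q} {P : Set p} {Q : Set q} (d : Dec P) (e : Dec Q) → (P → Q) → (Q → P) → ⟦ d ⟧ ≡ ⟦ e ⟧
  ⟦⟧-iff (yes p) (yes q) f g = refl
  ⟦⟧-iff (yes p) (no ¬q) f g = contradiction (f p) ¬q
  ⟦⟧-iff (no ¬p) (yes q) f g = contradiction (g q) ¬p
  ⟦⟧-iff (no ¬p) (no ¬q) f g = refl

  length-filter≡∑ : ∀ {a p} {A : Set a} {P : A → Set p} (P? : Decidable P) (xs : List A) →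
    + length (filter P? xs) ≡ ∑ xs (λ x → ⟦ P? x ⟧)
  length-filter≡∑ P? [] = refl
  length-filter≡∑ P? (x ∷ xs) with P? x
  ... | yes _ = trans (pos-+ 1 (length (filter P? xs))) (cong (λ z → 1ℤ + z) (length-filter≡∑ P? xs))
  ... | no _ = trans (length-filter≡∑ P? xs) (sym (+-identityˡ _))

  ⟦⟧-× : ∀ {p q r} {P : Set p} {Q : Set q} {R : Set r} (d : Dec P) (e : Dec Q) (f : Dec R) →
    (P → Q × R) → (Q → R → P) → ⟦ d ⟧ ≡ ⟦ e ⟧ * ⟦ f ⟧
  ⟦⟧-× (yes p) (yes q) (yes r) g h = refl
  ⟦⟧-× (yes p) (yes q) (no ¬r) g h = contradiction (proj₂ (g p)) ¬r
  ⟦⟧-× (yes p) (no ¬q) f g h = contradiction (proj₁ (g p)) ¬q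
  ⟦⟧-× (no ¬p) (yes q) (yes r) g h = contradiction (h q r) ¬p
  ⟦⟧-× (no ¬p) (yes q) (no ¬r) g h = refl
  ⟦⟧-× (no ¬p) (no ¬q) f g h = refl

  ⟦⟧-no : ∀ {p} {P : Set p} (d : Dec P) → ¬ P → ⟦ d ⟧ ≡ 0ℤ
  ⟦⟧-no (yes p) ¬p = contradiction p ¬p
  ⟦⟧-no (no _) _ = refl

  ⟦⟧-yes : ∀ {p} {P : Set p} (d : Dec P) → P → ⟦ d ⟧ ≡ 1ℤ
  ⟦⟧-yes (yes p) _ = refl
  ⟦⟧-yes (no ¬p) p = contradiction p ¬p

  ∑-tabulate-cong : ∀ {a b} {A : Set a} {B : Set b} (n : ℕ) (f : Fin n → A) (g : Fin n → B) (h : A → ℤ) (k : B → ℤ) →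
    (∀ i → h (f i) ≡ k (g i)) → ∑ (tabulate f) h ≡ ∑ (tabulate g) k
  ∑-tabulate-cong zero f g h k e = refl
  ∑-tabulate-cong (suc n) f g h k e = cong₂ _+_ (e zero) (∑-tabulate-cong n (f ∘ suc) (g ∘ suc) h k (e ∘ suc))

  ∑-allFin-suc : ∀ n (h : Fin (suc n) → ℤ) → ∑ (allFin (suc n)) h ≡ ∑ (allFin n) (h ∘ suc) + h zero
  ∑-allFin-suc n h = trans (cong (λ z → h zero + z) (∑-tabulate-cong n suc (λ i → i) h (h ∘ suc) (λ i → refl))) (+-comm (h zero) _)

  ∑-allFin-last : ∀ n (h : Fin (suc n) → ℤ) → ∑ (allFin (suc n)) h ≡ ∑ (allFin n) (h ∘ inject₁) + h (fromℕ n)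
  ∑-allFin-last n h = trans (∑-tabulate-last n (λ i → i) h) (cong (_+ h (fromℕ n)) (∑-tabulate-cong n inject₁ (λ i → i) h (h ∘ inject₁) (λ i → refl)))
    where
    ∑-tabulate-last : ∀ {B : Set} n (f : Fin (suc n) → B) (h : B → ℤ) → ∑ (tabulate f) h ≡ ∑ (tabulate (f ∘ inject₁)) h + h (f (fromℕ n))
    ∑-tabulate-last zero f h = trans (+-identityʳ (h (f zero))) (sym (+-identityˡ (h (f zero))))
    ∑-tabulate-last (suc n) f h = trans (cong (λ z → h (f zero) + z) (∑-tabulate-last n (f ∘ suc) h)) (sym (+-assoc (h (f zero)) _ _))

  ∑-zero : ∀ {a} {A : Set a} (xs : List A) (f : A → ℤ) → (∀ x → f x ≡ 0ℤ) → ∑ xs f ≡ 0ℤ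
  ∑-zero xs f e = trans (∑-cong xs e) (∑-0 xs)

  ∑-allFin-δ : ∀ n (a : Fin n) (h : Fin n → ℤ) → ∑ (allFin n) (λ i → ⟦ i ≟ a ⟧ * h i) ≡ h a
  ∑-allFin-δ (suc n) zero h = begin
      ∑ (allFin (suc n)) (λ i → ⟦ i ≟ zero ⟧ * h i)
    ≡⟨ ∑-allFin-suc n (λ i → ⟦ i ≟ zero ⟧ * h i) ⟩
      ∑ (allFin n) (λ i → ⟦ suc i ≟ zero ⟧ * h (suc i)) + 1ℤ * h zero
    ≡⟨ cong₂ _+_ (∑-zero (allFin n) _ (λ i → cong (_* h (suc i)) (⟦⟧-no (suc i ≟ zero) (λ ())))) (*-identityˡ (h zero)) ⟩
      0ℤ + h zero
    ≡⟨ +-identityˡ _ ⟩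
      h zero ∎
    where open ≡-Reasoning
  ∑-allFin-δ (suc n) (suc a) h = begin
      ∑ (allFin (suc n)) (λ i → ⟦ i ≟ suc a ⟧ * h i)
    ≡⟨ ∑-allFin-suc n (λ i → ⟦ i ≟ suc a ⟧ * h i) ⟩
      ∑ (allFin n) (λ i → ⟦ suc i ≟ suc a ⟧ * h (suc i)) + ⟦ zero ≟ suc a ⟧ * h zero
    ≡⟨ cong₂ _+_ (∑-cong (allFin n) (λ i → cong (_* h (suc i)) (⟦⟧-iff (suc i ≟ suc a) (i ≟ a) suc-injective (cong suc)))) (cong (_* h zero) (⟦⟧-no (zero ≟ suc a) (λ ()))) ⟩
      ∑ (allFin n) (λ i → ⟦ i ≟ a ⟧ * h (suc i)) + 0ℤ
    ≡⟨ trans (+-identityʳ _) (∑-allFin-δ n a (h ∘ suc)) ⟩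
      h (suc a) ∎
    where open ≡-Reasoning

  _≟V_ : ∀ {m n} → (x y : Vec (Fin n) m) → Dec (x ≡ y)
  _≟V_ = VecP.≡-dec _≟_

  ∑-allWords-δ : ∀ m n (b : Vec (Fin n) m) (h : Vec (Fin n) m → ℤ) → ∑ (allWords m n) (λ w → ⟦ w ≟V b ⟧ * h w) ≡ h b
  ∑-allWords-δ zero n [] h = trans (+-identityʳ _) (*-identityˡ _)
  ∑-allWords-δ (suc m) n (b ∷ bs) h = begin
      ∑ (allWords (suc m) n) (λ w → ⟦ w ≟V (b ∷ bs) ⟧ * h w)
    ≡⟨ ∑-concatMap (λ i → map (i ∷_) (allWords m n)) (allFin n) _ ⟩
      ∑ (allFin n) (λ i → ∑ (map (i ∷_) (allWords m n)) (λ w → ⟦ w ≟V (b ∷ bs) ⟧ * h w))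
    ≡⟨ ∑-cong (allFin n) (λ i → trans (∑-map (i ∷_) (allWords m n) _) (∑-cong (allWords m n) (split-head i))) ⟩
      ∑ (allFin n) (λ i → ∑ (allWords m n) (λ w → ⟦ i ≟ b ⟧ * (⟦ w ≟V bs ⟧ * h (i ∷ w))))
    ≡⟨ ∑-cong (allFin n) (λ i → ∑-* (allWords m n) ⟦ i ≟ b ⟧ _) ⟩
      ∑ (allFin n) (λ i → ⟦ i ≟ b ⟧ * ∑ (allWords m n) (λ w → ⟦ w ≟V bs ⟧ * h (i ∷ w)))
    ≡⟨ ∑-cong (allFin n) (λ i → cong (⟦ i ≟ b ⟧ *_) (∑-allWords-δ m n bs (λ w → h (i ∷ w)))) ⟩
      ∑ (allFin n) (λ i → ⟦ i ≟ b ⟧ * h (i ∷ bs))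
    ≡⟨ ∑-allFin-δ n b (λ i → h (i ∷ bs)) ⟩
      h (b ∷ bs) ∎
    where
    open ≡-Reasoning
    split-head : ∀ i w → ⟦ (i ∷ w) ≟V (b ∷ bs) ⟧ * h (i ∷ w) ≡ ⟦ i ≟ b ⟧ * (⟦ w ≟V bs ⟧ * h (i ∷ w))
    split-head i w = trans (cong (_* h (i ∷ w)) (⟦⟧-× ((i ∷ w) ≟V (b ∷ bs)) (i ≟ b) (w ≟V bs) ∷-injective (cong₂ _∷_)))
                           (*-assoc ⟦ i ≟ b ⟧ ⟦ w ≟V bs ⟧ (h (i ∷ w)))

  allMaybe : (n : ℕ) → List (Maybe (Fin n))
  allMaybe n = nothing ∷ map just (allFin n)

  _≟M_ : ∀ {n} → (x y : Maybe (Fin n)) → Dec (x ≡ y)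
  _≟M_ = MaybeP.≡-dec _≟_

  ∑-allMaybe-δ : ∀ n (b : Maybe (Fin n)) (h : Maybe (Fin n) → ℤ) → ∑ (allMaybe n) (λ o → ⟦ o ≟M b ⟧ * h o) ≡ h b
  ∑-allMaybe-δ n nothing h = begin
      1ℤ * h nothing + ∑ (map just (allFin n)) (λ o → ⟦ o ≟M nothing ⟧ * h o)
    ≡⟨ cong₂ _+_ (*-identityˡ (h nothing)) (trans (∑-map just (allFin n) _) (∑-zero (allFin n) _ just≢nothing)) ⟩
      h nothing + 0ℤ
    ≡⟨ +-identityʳ _ ⟩
      h nothing ∎
    where
    open ≡-Reasoning
    just≢nothing : ∀ i → ⟦ just i ≟M nothing ⟧ * h (just i) ≡ 0ℤ
    just≢nothing i = cong (_* h (just i)) (⟦⟧-no (just i ≟M nothing) (λ ()))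
  ∑-allMaybe-δ n (just b) h = begin
      0ℤ * h nothing + ∑ (map just (allFin n)) (λ o → ⟦ o ≟M just b ⟧ * h o)
    ≡⟨ trans (+-identityˡ _) (∑-map just (allFin n) _) ⟩
      ∑ (allFin n) (λ i → ⟦ just i ≟M just b ⟧ * h (just i))
    ≡⟨ ∑-cong (allFin n) (λ i → cong (_* h (just i)) (⟦⟧-iff (just i ≟M just b) (i ≟ b) MaybeP.just-injective (cong just))) ⟩
      ∑ (allFin n) (λ i → ⟦ i ≟ b ⟧ * h (just i))
    ≡⟨ ∑-allFin-δ n b (h ∘ just) ⟩
      h (just b) ∎
    where open ≡-Reasoning


module Iteration where

  open import Data.Nat as ℕ using (ℕ; zero; suc; _+_; _∸_; _≤_; _<_)
  open import Data.Nat.Properties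
  open import Data.Fin as Fin using (Fin; zero; suc; toℕ; fromℕ<)
  open import Data.Fin.Properties using (toℕ<n; toℕ-fromℕ<; pigeonhole)
  open import Data.Product using (∃; _,_)
  open import Relation.Binary.PropositionalEquality
  open import Relation.Nullary

  iterate : ∀ {n} → (Fin n → Fin n) → ℕ → Fin n → Fin n
  iterate f zero i = i
  iterate f (suc k) i = f (iterate f k i)

  iterate-+ : ∀ {n} (f : Fin n → Fin n) m p i → iterate f (m + p) i ≡ iterate f m (iterate f p i)
  iterate-+ f zero p i = refl
  iterate-+ f (suc m) p i = cong f (iterate-+ f m p i)

  iterate-cong : ∀ {n} {f g : Fin n → Fin n} → (∀ x → f x ≡ g x) → ∀ k i → iterate f k i ≡ iterate g k i
  iterate-cong e zero i = refl
  iterate-cong {g = g} e (suc k) i = trans (e _) (cong g (iterate-cong e k i))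

  -- Two of the first n + 1 iterates coincide (pigeonhole), so any exponent k ≥ n can be shortened.
  iterate-bounded : ∀ {n} (f : Fin n → Fin n) (i : Fin n) (k : ℕ) → ∃ λ (k' : Fin n) → iterate f k i ≡ iterate f (toℕ k') i
  iterate-bounded {n} f i k = go (suc k) k (n<1+n k)
    where
    go : ∀ fuel k → k < fuel → ∃ λ (k' : Fin n) → iterate f k i ≡ iterate f (toℕ k') i
    go (suc fuel) k k<f with k ℕ.<? n
    ... | yes k<n = fromℕ< k<n , cong (λ t → iterate f t i) (sym (toℕ-fromℕ< k<n))
    ... | no k≮n with pigeonhole (n<1+n n) (λ (t : Fin (suc n)) → iterate f (toℕ t) i)
    ...   | a , b , a<b , eq = let
              b≤n : toℕ b ≤ n
              b≤n = ≤-pred (toℕ<n b)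
              b≤k : toℕ b ≤ k
              b≤k = ≤-trans b≤n (≮⇒≥ k≮n)
              k′ = (k ∸ toℕ b) + toℕ a
              k′<k : k′ < k
              k′<k = subst (k′ <_) (m∸n+n≡m b≤k) (+-monoʳ-< (k ∸ toℕ b) a<b)
              (k' , e) = go fuel k′ (≤-trans k′<k (≤-pred k<f))
            in k' , (begin
                iterate f k i ≡⟨ cong (λ t → iterate f t i) (sym (m∸n+n≡m b≤k)) ⟩
                iterate f ((k ∸ toℕ b) + toℕ b) i ≡⟨ iterate-+ f (k ∸ toℕ b) (toℕ b) i ⟩
                iterate f (k ∸ toℕ b) (iterate f (toℕ b) i) ≡⟨ cong (iterate f (k ∸ toℕ b)) (sym eq) ⟩
                iterate f (k ∸ toℕ b) (iterate f (toℕ a) i) ≡⟨ sym (iterate-+ f (k ∸ toℕ b) (toℕ a) i) ⟩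
                iterate f k′ i ≡⟨ e ⟩
                iterate f (toℕ k') i ∎)
      where open ≡-Reasoning


module InsertLast where

  open import Data.Nat as ℕ using (ℕ; zero; suc; _≤_; _<_)
  open import Data.Nat.Properties using (≤-reflexive; <⇒≤; <⇒≱)
  open import Data.Fin as Fin using (Fin; zero; suc; toℕ; inject₁; fromℕ)
  open import Data.Fin.Properties using (_≟_; toℕ<n; toℕ-inject₁; toℕ-fromℕ)
  open import Data.Product using (∃; _×_; _,_)
  open import Data.Sum using (_⊎_; inj₁; inj₂)
  open import Data.Maybe using (Maybe; just; nothing)
  open import Data.Vec as Vec using (Vec; lookup)
  open import Data.Empty using (⊥-elim)
  open import Relation.Binary.PropositionalEquality
  open import Relation.Nullary
  open Iteration

  old : ∀ {n} → Fin n → Fin (suc n)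
  old = inject₁

  new : ∀ n → Fin (suc n)
  new n = fromℕ n

  toℕ-old : ∀ {n} (y : Fin n) → toℕ (old y) ≡ toℕ y
  toℕ-old = toℕ-inject₁

  toℕ-new : ∀ n → toℕ (new n) ≡ n
  toℕ-new = toℕ-fromℕ

  data Split {n : ℕ} : Fin (suc n) → Set where
    at-old : (y : Fin n) → Split (old y)
    at-new : Split (new n)

  split : ∀ {n} (x : Fin (suc n)) → Split x
  split {zero} zero = at-new
  split {suc n} zero = at-old zero
  split {suc n} (suc x) with split x
  ... | at-old y = at-old (suc y)
  ... | at-new = at-new

  split-inject₁ : ∀ {n} (y : Fin n) → split (old y) ≡ at-old y
  split-inject₁ {suc n} zero = refl
  split-inject₁ {suc n} (suc y) rewrite split-inject₁ y = refl

  split-fromℕ : ∀ n → split (new n) ≡ at-new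
  split-fromℕ zero = refl
  split-fromℕ (suc n) rewrite split-fromℕ n = refl

  -- insertLast s nothing extends s by the fixed point n; insertLast s (just j) puts n into the cycle of j, right after j.
  module _ {n : ℕ} (s : Fin n → Fin n) where
    private
      go : Maybe (Fin n) → ∀ x → Split {n} x → Fin (suc n)
      go nothing _ (at-old y) = old (s y)
      go nothing _ at-new = new n
      go (just j) _ (at-old y) with y ≟ j
      ... | yes _ = new n
      ... | no _ = old (s y)
      go (just j) _ at-new = old (s j)

    insertLast : Maybe (Fin n) → Fin (suc n) → Fin (suc n)
    insertLast o x = go o x (split x)

    extend-old : ∀ y → insertLast nothing (old y) ≡ old (s y)
    extend-old y = cong (go nothing (old y)) (split-inject₁ y)

    extend-new : insertLast nothing (new n) ≡ new n
    extend-new = cong (go nothing (new n)) (split-fromℕ n)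

    splice-new : ∀ j → insertLast (just j) (new n) ≡ old (s j)
    splice-new j = cong (go (just j) (new n)) (split-fromℕ n)

    splice-at : ∀ j → insertLast (just j) (old j) ≡ new n
    splice-at j = trans (cong (go (just j) (old j)) (split-inject₁ j)) resolve
      where resolve : go (just j) (old j) (at-old j) ≡ new n
            resolve with j ≟ j
            ... | yes _ = refl
            ... | no ¬e = ⊥-elim (¬e refl)

    splice-old : ∀ j y → y ≢ j → insertLast (just j) (old y) ≡ old (s y)
    splice-old j y ne = trans (cong (go (just j) (old y)) (split-inject₁ y)) resolve
      where resolve : go (just j) (old y) (at-old y) ≡ old (s y)
            resolve with y ≟ j
            ... | yes e = ⊥-elim (ne e)
            ... | no _ = refl

  -- Unlike CycleMin, which only scans the exponents below n, this quantifies over all exponents.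
  IsCycleMin : ∀ {n} → (Fin n → Fin n) → Fin n → Set
  IsCycleMin f i = ∀ k → toℕ i ≤ toℕ (iterate f k i)

  iter≡iterate : ∀ {n} (v : Vec (Fin n) n) k i → iter v k i ≡ iterate (lookup v) k i
  iter≡iterate v zero i = refl
  iter≡iterate v (suc k) i = cong (lookup v) (iter≡iterate v k i)

  CycleMin⇒IsCycleMin : ∀ {n} (v : Vec (Fin n) n) i → CycleMin v i → IsCycleMin (lookup v) i
  CycleMin⇒IsCycleMin v i cm k with iterate-bounded (lookup v) i k
  ... | k' , e = subst (λ z → toℕ i ≤ toℕ z) (trans (iter≡iterate v (toℕ k') i) (sym e)) (cm k')

  IsCycleMin⇒CycleMin : ∀ {n} (v : Vec (Fin n) n) i → IsCycleMin (lookup v) i → CycleMin v i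
  IsCycleMin⇒CycleMin v i cm k = subst (λ z → toℕ i ≤ toℕ z) (sym (iter≡iterate v (toℕ k) i)) (cm (toℕ k))

  module _ {n : ℕ} (s : Fin n → Fin n) where
    iterate-extend-old : ∀ k y → iterate (insertLast s nothing) k (old y) ≡ old (iterate s k y)
    iterate-extend-old zero y = refl
    iterate-extend-old (suc k) y = trans (cong (insertLast s nothing) (iterate-extend-old k y)) (extend-old s _)

    iterate-extend-new : ∀ k → iterate (insertLast s nothing) k (new n) ≡ new n
    iterate-extend-new zero = refl
    iterate-extend-new (suc k) = trans (cong (insertLast s nothing) (iterate-extend-new k)) (extend-new s)

    extend-old-cycleMin⁻ : ∀ y → IsCycleMin (insertLast s nothing) (old y) → IsCycleMin s y
    extend-old-cycleMin⁻ y cm k = subst₂ _≤_ (toℕ-inject₁ y) (trans (cong toℕ (iterate-extend-old k y)) (toℕ-inject₁ _)) (cm k)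

    extend-old-cycleMin : ∀ y → IsCycleMin s y → IsCycleMin (insertLast s nothing) (old y)
    extend-old-cycleMin y cm k = subst₂ _≤_ (sym (toℕ-inject₁ y)) (sym (trans (cong toℕ (iterate-extend-old k y)) (toℕ-inject₁ _))) (cm k)

    extend-new-cycleMin : IsCycleMin (insertLast s nothing) (new n)
    extend-new-cycleMin k = ≤-reflexive (cong toℕ (sym (iterate-extend-new k)))

    module _ (j : Fin n) where
      private f' = insertLast s (just j)

      iterate-splice-old : ∀ i k → (∃ λ k' → iterate f' k (old i) ≡ old (iterate s k' i)) ⊎ (iterate f' k (old i) ≡ new n × ∃ λ k' → iterate s k' i ≡ j)
      iterate-splice-old i zero = inj₁ (0 , refl)
      iterate-splice-old i (suc k) with iterate-splice-old i k
      ... | inj₂ (e , k' , ej) = inj₁ (suc k' , trans (cong f' e) (trans (splice-new s j) (cong (λ z → old (s z)) (sym ej))))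
      ... | inj₁ (k' , e) with iterate s k' i ≟ j
      ...   | yes yj = inj₂ (trans (cong f' (trans e (cong old yj))) (splice-at s j) , k' , yj)
      ...   | no ¬yj = inj₁ (suc k' , trans (cong f' e) (splice-old s j _ ¬yj))

      iterate-splice-old⁻ : ∀ i k' → ∃ λ k → iterate f' k (old i) ≡ old (iterate s k' i)
      iterate-splice-old⁻ i zero = 0 , refl
      iterate-splice-old⁻ i (suc k') with iterate-splice-old⁻ i k' | iterate s k' i ≟ j
      ... | k , e | yes yj = suc (suc k) , trans (cong f' (trans (cong f' (trans e (cong old yj))) (splice-at s j))) (trans (splice-new s j) (cong (λ z → old (s z)) (sym yj)))
      ... | k , e | no ¬yj = suc k , trans (cong f' e) (splice-old s j _ ¬yj)

      splice-old-cycleMin⁻ : ∀ i → IsCycleMin f' (old i) → IsCycleMin s i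
      splice-old-cycleMin⁻ i cm k' with iterate-splice-old⁻ i k'
      ... | k , e = subst₂ _≤_ (toℕ-inject₁ i) (trans (cong toℕ e) (toℕ-inject₁ _)) (cm k)

      splice-old-cycleMin : ∀ i → IsCycleMin s i → IsCycleMin f' (old i)
      splice-old-cycleMin i cm k with iterate-splice-old i k
      ... | inj₁ (k' , e) = subst₂ _≤_ (sym (toℕ-inject₁ i)) (sym (trans (cong toℕ e) (toℕ-inject₁ _))) (cm k')
      ... | inj₂ (e , _) = subst₂ _≤_ (sym (toℕ-inject₁ i)) (trans (sym (toℕ-fromℕ n)) (cong toℕ (sym e))) (<⇒≤ (toℕ<n i))

      splice-new-not-cycleMin : ¬ IsCycleMin f' (new n)
      splice-new-not-cycleMin cm = <⇒≱ (toℕ<n (s j)) (subst₂ _≤_ (toℕ-fromℕ n) (toℕ-inject₁ (s j)) q)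
        where
        q : toℕ (new n) ≤ toℕ (old (s j))
        q = subst (λ z → toℕ (new n) ≤ toℕ z) (splice-new s j) (cm 1)


module InsertRemove where

  open import Data.Nat as ℕ using (ℕ; zero; suc; _+_; _<_)
  import Data.Nat.Properties as ℕP
  open import Data.Fin as Fin using (Fin; zero; suc; toℕ)
  open import Data.Fin.Properties using (_≟_; inject₁-injective; fromℕ≢inject₁; any?; pigeonhole)
  open import Data.Product using (∃; _×_; _,_)
  open import Data.Sum using (_⊎_; inj₁; inj₂)
  open import Data.Maybe using (Maybe; just; nothing)
  open import Data.Vec as Vec using (Vec; lookup; tabulate)
  open import Data.Vec.Properties using (lookup∘tabulate; tabulate∘lookup; tabulate-cong)
  open import Relation.Binary.PropositionalEquality
  open import Relation.Nullary
  open import Data.Empty using (⊥-elim)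
  open Iteration
  open InsertLast

  insert : ∀ {n} → Vec (Fin n) n → Maybe (Fin n) → Vec (Fin (suc n)) (suc n)
  insert u o = tabulate (insertLast (lookup u) o)

  lookup-insert : ∀ {n} (u : Vec (Fin n) n) o x → lookup (insert u o) x ≡ insertLast (lookup u) o x
  lookup-insert u o x = lookup∘tabulate (insertLast (lookup u) o) x

  module _ {n} (u : Vec (Fin n) n) where
    lookup-extend-old : ∀ y → lookup (insert u nothing) (old y) ≡ old (lookup u y)
    lookup-extend-old y = trans (lookup-insert u nothing (old y)) (extend-old (lookup u) y)

    lookup-extend-new : lookup (insert u nothing) (new n) ≡ new n
    lookup-extend-new = trans (lookup-insert u nothing (new n)) (extend-new (lookup u))

    lookup-splice-new : ∀ j → lookup (insert u (just j)) (new n) ≡ old (lookup u j)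
    lookup-splice-new j = trans (lookup-insert u (just j) (new n)) (splice-new (lookup u) j)

    lookup-splice-at : ∀ j → lookup (insert u (just j)) (old j) ≡ new n
    lookup-splice-at j = trans (lookup-insert u (just j) (old j)) (splice-at (lookup u) j)

    lookup-splice-old : ∀ j y → y ≢ j → lookup (insert u (just j)) (old y) ≡ old (lookup u y)
    lookup-splice-old j y y≢j = trans (lookup-insert u (just j) (old y)) (splice-old (lookup u) j y y≢j)

  new≢old : ∀ {n} {y : Fin n} → new n ≢ old y
  new≢old = fromℕ≢inject₁

  insertLast-injective : ∀ {n} (s : Fin n → Fin n) o → (∀ a b → s a ≡ s b → a ≡ b) → ∀ x y → insertLast s o x ≡ insertLast s o y → x ≡ y
  insertLast-injective {n} s o si x y e = by-cases o x y (split x) (split y) e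
    where
    by-cases : ∀ o x y → Split x → Split y → insertLast s o x ≡ insertLast s o y → x ≡ y
    by-cases nothing _ _ (at-old a) (at-old b) e = cong old (si a b (inject₁-injective (trans (sym (extend-old s a)) (trans e (extend-old s b)))))
    by-cases nothing _ _ (at-old a) at-new e = ⊥-elim (new≢old (sym (trans (sym (extend-old s a)) (trans e (extend-new s)))))
    by-cases nothing _ _ at-new (at-old b) e = ⊥-elim (new≢old (trans (sym (extend-new s)) (trans e (extend-old s b))))
    by-cases nothing _ _ at-new at-new e = refl
    by-cases (just j) _ _ (at-old a) (at-old b) e with a ≟ j | b ≟ j
    ... | yes aj | yes bj = cong old (trans aj (sym bj))
    ... | yes aj | no bj = ⊥-elim (new≢old (trans (sym (splice-at s j)) (trans (cong (λ z → insertLast s (just j) (old z)) (sym aj)) (trans e (splice-old s j b bj)))))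
    ... | no aj | yes bj = ⊥-elim (new≢old (trans (sym (splice-at s j)) (trans (cong (λ z → insertLast s (just j) (old z)) (sym bj)) (trans (sym e) (splice-old s j a aj)))))
    ... | no aj | no bj = cong old (si a b (inject₁-injective (trans (sym (splice-old s j a aj)) (trans e (splice-old s j b bj)))))
    by-cases (just j) _ _ (at-old a) at-new e with a ≟ j
    ... | yes aj = ⊥-elim (new≢old (trans (sym (splice-at s j)) (trans (cong (λ z → insertLast s (just j) (old z)) (sym aj)) (trans e (splice-new s j)))))
    ... | no aj = ⊥-elim (aj (si a j (inject₁-injective (trans (sym (splice-old s j a aj)) (trans e (splice-new s j))))))
    by-cases (just j) _ _ at-new (at-old b) e with b ≟ j
    ... | yes bj = ⊥-elim (new≢old (trans (sym (splice-at s j)) (trans (cong (λ z → insertLast s (just j) (old z)) (sym bj)) (trans (sym e) (splice-new s j)))))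
    ... | no bj = ⊥-elim (bj (si b j (inject₁-injective (trans (sym (splice-old s j b bj)) (trans (sym e) (splice-new s j))))))
    by-cases (just j) _ _ at-new at-new e = refl

  insertLast-injective⁻ : ∀ {n} (s : Fin n → Fin n) o → (∀ x y → insertLast s o x ≡ insertLast s o y → x ≡ y) → ∀ a b → s a ≡ s b → a ≡ b
  insertLast-injective⁻ s nothing fi a b e = inject₁-injective (fi (old a) (old b) (trans (extend-old s a) (trans (cong old e) (sym (extend-old s b)))))
  insertLast-injective⁻ s (just j) fi a b e with a ≟ j | b ≟ j
  ... | yes aj | yes bj = trans aj (sym bj)
  ... | yes aj | no bj = ⊥-elim (new≢old (fi (new _) (old b) (trans (splice-new s j) (trans (cong (λ z → old (s z)) (sym aj)) (trans (cong old e) (sym (splice-old s j b bj)))))))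
  ... | no aj | yes bj = ⊥-elim (new≢old (fi (new _) (old a) (trans (splice-new s j) (trans (cong (λ z → old (s z)) (sym bj)) (trans (cong old (sym e)) (sym (splice-old s j a aj)))))))
  ... | no aj | no bj = inject₁-injective (fi (old a) (old b) (trans (splice-old s j a aj) (trans (cong old e) (sym (splice-old s j b bj)))))

  insert-perm : ∀ {n} (u : Vec (Fin n) n) o → IsPerm u → IsPerm (insert u o)
  insert-perm u o pu x y e = insertLast-injective (lookup u) o pu x y (trans (sym (lookup-insert u o x)) (trans e (lookup-insert u o y)))

  insert-perm⁻ : ∀ {n} (u : Vec (Fin n) n) o → IsPerm (insert u o) → IsPerm u
  insert-perm⁻ u o pv = insertLast-injective⁻ (lookup u) o (λ x y e → pv x y (trans (lookup-insert u o x) (trans e (sym (lookup-insert u o y)))))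

  -- The default d is returned for new n, where no old point is available.
  lowerSplit : ∀ {n} → Fin n → ∀ x → Split {n} x → Fin n
  lowerSplit d _ (at-old y) = y
  lowerSplit d _ at-new = d

  lower : ∀ {n} → Fin n → Fin (suc n) → Fin n
  lower d x = lowerSplit d x (split x)

  lower-old : ∀ {n} (d y : Fin n) → lower d (old y) ≡ y
  lower-old d y = cong (lowerSplit d (old y)) (split-inject₁ y)

  old-lower : ∀ {n} (d : Fin n) x → x ≢ new n → old (lower d x) ≡ x
  old-lower {n} d x ne = by-cases x (split x) ne
    where by-cases : ∀ x (w : Split {n} x) → x ≢ new n → old (lowerSplit d x w) ≡ x
          by-cases _ (at-old y) _ = refl
          by-cases _ at-new ne = ⊥-elim (ne refl)

  module _ {n : ℕ} (v : Vec (Fin (suc n)) (suc n)) where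
    private
      t = lookup v

    removeLastAt : (i : Fin n) → Dec (t (old i) ≡ new n) → Fin n
    removeLastAt i (yes _) = lower i (t (new n))
    removeLastAt i (no _) = lower i (t (old i))

    removeLastF : Fin n → Fin n
    removeLastF i = removeLastAt i (t (old i) ≟ new n)

    removeLast : Vec (Fin n) n
    removeLast = tabulate removeLastF

    removeLast-spec : ∀ i → (t (old i) ≡ new n × removeLastF i ≡ lower i (t (new n))) ⊎ (t (old i) ≢ new n × removeLastF i ≡ lower i (t (old i)))
    removeLast-spec i = by-cases (t (old i) ≟ new n)
      where by-cases : (d : Dec (t (old i) ≡ new n)) → (t (old i) ≡ new n × removeLastAt i d ≡ lower i (t (new n))) ⊎ (t (old i) ≢ new n × removeLastAt i d ≡ lower i (t (old i)))
            by-cases (yes p) = inj₁ (p , refl)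
            by-cases (no p) = inj₂ (p , refl)

    positionAt : Dec (∃ λ i → t (old i) ≡ new n) → Maybe (Fin n)
    positionAt (yes (j , _)) = just j
    positionAt (no _) = nothing

    position : Maybe (Fin n)
    position = positionAt (any? (λ i → t (old i) ≟ new n))

    position-spec : (∃ λ j → position ≡ just j × t (old j) ≡ new n) ⊎ (position ≡ nothing × (∀ i → t (old i) ≢ new n))
    position-spec = by-cases (any? (λ i → t (old i) ≟ new n))
      where by-cases : (d : Dec (∃ λ i → t (old i) ≡ new n)) → (∃ λ j → positionAt d ≡ just j × t (old j) ≡ new n) ⊎ (positionAt d ≡ nothing × (∀ i → t (old i) ≢ new n))
            by-cases (yes (j , p)) = inj₁ (j , refl , p)
            by-cases (no ¬p) = inj₂ (refl , λ i e → ¬p (i , e))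

    never-new : ∀ x → (∀ i → t (old i) ≢ new n) → t (new n) ≢ new n → t x ≢ new n
    never-new x h h' = by-cases x (split x)
      where by-cases : ∀ x → Split {n} x → t x ≢ new n
            by-cases _ (at-old i) = h i
            by-cases _ at-new = h'

    -- If t (new n) ≢ new n, then t misses new n altogether and pigeonhole on lower ∘ t contradicts injectivity.
    fixes-new : IsPerm v → (∀ i → t (old i) ≢ new n) → t (new n) ≡ new n
    fixes-new pv h = by-cases n refl
      where
      by-cases : ∀ m → m ≡ n → t (new n) ≡ new n
      by-cases zero refl with t (new 0)
      ... | zero = refl
      by-cases (suc m) refl with t (new n) ≟ new n
      ... | yes e = e
      ... | no ne with pigeonhole (ℕP.n<1+n n) (λ x → lower zero (t x))
      ...   | a , b , a<b , eq = ⊥-elim (ℕP.<-irrefl (cong toℕ ab) a<b)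
        where
        tab : t a ≡ t b
        tab = trans (sym (old-lower zero (t a) (never-new a h ne))) (trans (cong old eq) (old-lower zero (t b) (never-new b h ne)))
        ab : a ≡ b
        ab = pv a b tab

  position-insert : ∀ {n} (u : Vec (Fin n) n) o → position (insert u o) ≡ o
  position-insert {n} u o with position-spec (insert u o)
  position-insert {n} u nothing | inj₁ (j , e , tj) = ⊥-elim (new≢old (sym (trans (sym (lookup-extend-old u j)) tj)))
  position-insert {n} u (just j) | inj₁ (j' , e , tj) with j' ≟ j
  ... | yes jj = trans e (cong just jj)
  ... | no jj = ⊥-elim (new≢old (sym (trans (sym (lookup-splice-old u j j' jj)) tj)))
  position-insert {n} u nothing | inj₂ (e , _) = e
  position-insert {n} u (just j) | inj₂ (e , h) = ⊥-elim (h j (lookup-splice-at u j))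

  removeLast-insert : ∀ {n} (u : Vec (Fin n) n) o → removeLast (insert u o) ≡ u
  removeLast-insert {n} u nothing = trans (tabulate-cong pointwise) (tabulate∘lookup u)
    where
    s = lookup u
    pointwise : ∀ i → removeLastF (insert u nothing) i ≡ lookup u i
    pointwise i with removeLast-spec (insert u nothing) i
    ... | inj₁ (e , r) = ⊥-elim (new≢old (sym (trans (sym (lookup-extend-old u i)) e)))
    ... | inj₂ (e , r) = trans r (trans (cong (lower i) (lookup-extend-old u i)) (lower-old i (s i)))
  removeLast-insert {n} u (just j) = trans (tabulate-cong pointwise) (tabulate∘lookup u)
    where
    s = lookup u
    pointwise : ∀ i → removeLastF (insert u (just j)) i ≡ lookup u i
    pointwise i with removeLast-spec (insert u (just j)) i | i ≟ j
    ... | inj₁ (e , r) | yes ij = trans r (trans (cong (lower i) (lookup-splice-new u j)) (trans (lower-old i (s j)) (cong s (sym ij))))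
    ... | inj₁ (e , r) | no ij = ⊥-elim (new≢old (sym (trans (sym (lookup-splice-old u j i ij)) e)))
    ... | inj₂ (e , r) | yes ij = ⊥-elim (e (trans (lookup-insert u (just j) (old i)) (trans (cong (λ z → insertLast s (just j) (old z)) ij) (splice-at s j))))
    ... | inj₂ (e , r) | no ij = trans r (trans (cong (lower i) (lookup-splice-old u j i ij)) (lower-old i (s i)))

  insert-removeLast : ∀ {n} (v : Vec (Fin (suc n)) (suc n)) → IsPerm v → insert (removeLast v) (position v) ≡ v
  insert-removeLast {n} v pv = trans (tabulate-cong pointwise) (tabulate∘lookup v)
    where
    t = lookup v
    s = lookup (removeLast v)
    s≡ : ∀ i → s i ≡ removeLastF v i
    s≡ i = lookup∘tabulate (removeLastF v) i
    pointwise : ∀ x → insertLast s (position v) x ≡ t x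
    pointwise x with position-spec v
    ... | inj₁ (j , oe , tj) rewrite oe = by-cases x (split x)
      where
      by-cases : ∀ x → Split {n} x → insertLast s (just j) x ≡ t x
      by-cases _ (at-old y) with y ≟ j
      ... | yes yj = trans (cong (λ z → insertLast s (just j) (old z)) yj) (trans (splice-at s j) (trans (sym tj) (cong (λ z → t (old z)) (sym yj))))
      ... | no yj with removeLast-spec v y
      ...   | inj₁ (e , _) = ⊥-elim (yj (inject₁-injective (pv (old y) (old j) (trans e (sym tj)))))
      ...   | inj₂ (ne , r) = trans (splice-old s j y yj) (trans (cong old (trans (s≡ y) r)) (old-lower y (t (old y)) ne))
      by-cases _ at-new with removeLast-spec v j
      ... | inj₂ (ne , _) = ⊥-elim (ne tj)
      ... | inj₁ (_ , r) = trans (splice-new s j) (trans (cong old (trans (s≡ j) r)) (old-lower j (t (new n)) (λ e → new≢old (pv (new n) (old j) (trans e (sym tj))))))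
    ... | inj₂ (oe , h) rewrite oe = by-cases x (split x)
      where
      by-cases : ∀ x → Split {n} x → insertLast s nothing x ≡ t x
      by-cases _ (at-old y) with removeLast-spec v y
      ... | inj₁ (e , _) = ⊥-elim (h y e)
      ... | inj₂ (ne , r) = trans (extend-old s y) (trans (cong old (trans (s≡ y) r)) (old-lower y (t (old y)) ne))
      by-cases _ at-new = trans (extend-new s) (sym (fixes-new v pv h))


module InsertionStatistics where

  open import Data.Nat as ℕ using (ℕ; zero; suc; _∸_; _%_; _≤_)
  import Data.Nat.Properties as ℕP
  open import Data.Integer as ℤ using (ℤ; +_; 0ℤ; 1ℤ; _+_; _*_; -_; _-_)
  open import Data.Integer.Properties hiding (_≟_)
  open import Data.Fin as Fin using (Fin; toℕ)
  open import Data.Fin.Properties using (_≟_; inject₁-injective)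
  open import Data.Vec using (Vec; lookup)
  open import Data.Maybe using (just; nothing)
  open import Data.List using (filter; length; allFin)
  import Data.List.Properties as LP
  open import Data.Product using (_×_; _,_)
  open import Data.Sum using (_⊎_; inj₁; inj₂)
  open import Data.Empty using (⊥-elim)
  open import Relation.Binary.PropositionalEquality
  open import Relation.Nullary
  open import Relation.Nullary.Decidable using (_×-dec_)
  open import Relation.Unary using (Decidable)
  open IndicatorSums
  open Iteration
  open InsertLast
  open InsertRemove
  open import Data.Nat.DivMod using ([m+n]%n≡m%n)

  module _ {n : ℕ} (u : Vec (Fin n) n) where
    private s = lookup u

    extend-parityAlt⁻ : ParityAlt (insert u nothing) → ParityAlt u
    extend-parityAlt⁻ P i = subst₂ _≡_ (cong (_% 2) (trans (cong toℕ (lookup-extend-old u i)) (toℕ-old (s i)))) (cong (_% 2) (toℕ-old i)) (P (old i))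

    extend-parityAlt : ParityAlt u → ParityAlt (insert u nothing)
    extend-parityAlt P x = by-cases x (split x)
      where by-cases : ∀ x → Split {n} x → toℕ (lookup (insert u nothing) x) % 2 ≡ toℕ x % 2
            by-cases _ (at-old y) = subst₂ _≡_ (cong (_% 2) (sym (trans (cong toℕ (lookup-extend-old u y)) (toℕ-old (s y))))) (cong (_% 2) (sym (toℕ-old y))) (P y)
            by-cases _ at-new = cong (λ z → toℕ z % 2) (lookup-extend-new u)

    module _ (j : Fin n) where
      splice-parityAlt⁻ : ParityAlt (insert u (just j)) → ParityAlt u × toℕ j % 2 ≡ n % 2
      splice-parityAlt⁻ P = pu , cj
        where
        cj : toℕ j % 2 ≡ n % 2
        cj = sym (subst₂ _≡_ (cong (_% 2) (trans (cong toℕ (lookup-splice-at u j)) (toℕ-new n))) (cong (_% 2) (toℕ-old j)) (P (old j)))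
        pu : ParityAlt u
        pu i with i ≟ j
        ... | yes refl = trans (subst₂ _≡_ (cong (_% 2) (trans (cong toℕ (lookup-splice-new u j)) (toℕ-old (s j)))) (cong (_% 2) (toℕ-new n)) (P (new n))) (sym cj)
        ... | no ij = subst₂ _≡_ (cong (_% 2) (trans (cong toℕ (lookup-splice-old u j i ij)) (toℕ-old (s i)))) (cong (_% 2) (toℕ-old i)) (P (old i))

      splice-parityAlt : ParityAlt u × toℕ j % 2 ≡ n % 2 → ParityAlt (insert u (just j))
      splice-parityAlt (P , cj) x = by-cases x (split x)
        where by-cases : ∀ x → Split {n} x → toℕ (lookup (insert u (just j)) x) % 2 ≡ toℕ x % 2
              by-cases _ (at-old y) with y ≟ j
              ... | yes refl = trans (cong (_% 2) (trans (cong toℕ (trans (lookup-insert u (just j) (old y)) (splice-at s j))) (toℕ-new n))) (trans (sym cj) (cong (_% 2) (sym (toℕ-old y))))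
              ... | no yj = subst₂ _≡_ (cong (_% 2) (sym (trans (cong toℕ (lookup-splice-old u j y yj)) (toℕ-old (s y))))) (cong (_% 2) (sym (toℕ-old y))) (P y)
              by-cases _ at-new = trans (cong (_% 2) (trans (cong toℕ (lookup-splice-new u j)) (toℕ-old (s j)))) (trans (P j) (trans cj (cong (_% 2) (sym (toℕ-new n)))))

  IsCycleMin-cong : ∀ {n} {f g : Fin n → Fin n} → (∀ x → f x ≡ g x) → ∀ i → IsCycleMin f i → IsCycleMin g i
  IsCycleMin-cong e i cm k = subst (λ z → toℕ i ≤ toℕ z) (iterate-cong e k i) (cm k)

  module _ {n : ℕ} (u : Vec (Fin n) n) where
    private s = lookup u

    insert-cycleMin⁻ : ∀ o x → CycleMin (insert u o) x → IsCycleMin (insertLast s o) x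
    insert-cycleMin⁻ o x c = IsCycleMin-cong (lookup-insert u o) x (CycleMin⇒IsCycleMin (insert u o) x c)

    insert-cycleMin : ∀ o x → IsCycleMin (insertLast s o) x → CycleMin (insert u o) x
    insert-cycleMin o x c = IsCycleMin⇒CycleMin (insert u o) x (IsCycleMin-cong (λ y → sym (lookup-insert u o y)) x c)

    cycles≡∑ : ∀ {m} (v : Vec (Fin m) m) → + cycles v ≡ ∑ (allFin m) (λ i → ⟦ cycleMin? v i ⟧)
    cycles≡∑ v = length-filter≡∑ (cycleMin? v) (allFin _)

    cycles-extend : cycles (insert u nothing) ≡ suc (cycles u)
    cycles-extend = +-injective (begin
        + cycles (insert u nothing)
      ≡⟨ cycles≡∑ (insert u nothing) ⟩
        ∑ (allFin (suc n)) (λ i → ⟦ cycleMin? (insert u nothing) i ⟧)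
      ≡⟨ ∑-allFin-last n (λ i → ⟦ cycleMin? (insert u nothing) i ⟧) ⟩
        ∑ (allFin n) (λ i → ⟦ cycleMin? (insert u nothing) (old i) ⟧) + ⟦ cycleMin? (insert u nothing) (new n) ⟧
      ≡⟨ cong₂ _+_ (∑-cong (allFin n) (λ i → ⟦⟧-iff (cycleMin? (insert u nothing) (old i)) (cycleMin? u i)
             (λ c → IsCycleMin⇒CycleMin u i (extend-old-cycleMin⁻ s i (insert-cycleMin⁻ nothing (old i) c))) (λ c → insert-cycleMin nothing (old i) (extend-old-cycleMin s i (CycleMin⇒IsCycleMin u i c)))))
           (⟦⟧-yes (cycleMin? (insert u nothing) (new n)) (insert-cycleMin nothing (new n) (extend-new-cycleMin s))) ⟩
        ∑ (allFin n) (λ i → ⟦ cycleMin? u i ⟧) + 1ℤ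
      ≡⟨ cong (_+ 1ℤ) (sym (cycles≡∑ u)) ⟩
        + cycles u + 1ℤ
      ≡⟨ +-comm (+ cycles u) 1ℤ ⟩
        + suc (cycles u) ∎)
      where open ≡-Reasoning

    cycles-splice : ∀ j → cycles (insert u (just j)) ≡ cycles u
    cycles-splice j = +-injective (begin
        + cycles (insert u (just j))
      ≡⟨ cycles≡∑ (insert u (just j)) ⟩
        ∑ (allFin (suc n)) (λ i → ⟦ cycleMin? (insert u (just j)) i ⟧)
      ≡⟨ ∑-allFin-last n (λ i → ⟦ cycleMin? (insert u (just j)) i ⟧) ⟩
        ∑ (allFin n) (λ i → ⟦ cycleMin? (insert u (just j)) (old i) ⟧) + ⟦ cycleMin? (insert u (just j)) (new n) ⟧
      ≡⟨ cong₂ _+_ (∑-cong (allFin n) (λ i → ⟦⟧-iff (cycleMin? (insert u (just j)) (old i)) (cycleMin? u i)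
             (λ c → IsCycleMin⇒CycleMin u i (splice-old-cycleMin⁻ s j i (insert-cycleMin⁻ (just j) (old i) c))) (λ c → insert-cycleMin (just j) (old i) (splice-old-cycleMin s j i (CycleMin⇒IsCycleMin u i c)))))
           (⟦⟧-no (cycleMin? (insert u (just j)) (new n)) (λ c → splice-new-not-cycleMin s j (insert-cycleMin⁻ (just j) (new n) c))) ⟩
        ∑ (allFin n) (λ i → ⟦ cycleMin? u i ⟧) + 0ℤ
      ≡⟨ trans (+-identityʳ _) (sym (cycles≡∑ u)) ⟩
        + cycles u ∎)
      where open ≡-Reasoning

  sign : ∀ {p} {P : Set p} → Dec P → ℤ
  sign (yes _) = 1ℤ
  sign (no _) = - 1ℤ

  sign-iff : ∀ {p q} {P : Set p} {Q : Set q} (d : Dec P) (e : Dec Q) → (P → Q) → (Q → P) → sign d ≡ sign e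
  sign-iff (yes p) (yes q) f g = refl
  sign-iff (yes p) (no ¬q) f g = ⊥-elim (¬q (f p))
  sign-iff (no ¬p) (yes q) f g = ⊥-elim (¬p (g q))
  sign-iff (no ¬p) (no ¬q) f g = refl

  sign-flip : ∀ {p q} {P : Set p} {Q : Set q} (d : Dec P) (e : Dec Q) → (P → ¬ Q) → (¬ Q → P) → sign d ≡ - sign e
  sign-flip (yes p) (yes q) f g = ⊥-elim (f p q)
  sign-flip (yes p) (no ¬q) f g = refl
  sign-flip (no ¬p) (yes q) f g = refl
  sign-flip (no ¬p) (no ¬q) f g = ⊥-elim (¬p (g ¬q))

  %2-step : ∀ m → suc (suc m) % 2 ≡ m % 2
  %2-step m = trans (cong (_% 2) (ℕP.+-comm 2 m)) ([m+n]%n≡m%n m 2)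

  parity : ∀ m → (m % 2 ≡ 0 × suc m % 2 ≡ 1) ⊎ (m % 2 ≡ 1 × suc m % 2 ≡ 0)
  parity zero = inj₁ (refl , refl)
  parity (suc m) with parity m
  ... | inj₁ (a , b) = inj₂ (b , trans (%2-step m) a)
  ... | inj₂ (a , b) = inj₁ (b , trans (%2-step m) a)

  parity-suc⇒ : ∀ m → suc m % 2 ≡ 0 → ¬ (m % 2 ≡ 0)
  parity-suc⇒ m e e' with parity m
  ... | inj₁ (_ , b) = ℕP.1+n≢0 (trans (sym b) e)
  ... | inj₂ (a , _) = ℕP.1+n≢0 (trans (sym a) e')

  parity-suc⇐ : ∀ m → ¬ (m % 2 ≡ 0) → suc m % 2 ≡ 0
  parity-suc⇐ m ne with parity m
  ... | inj₁ (a , _) = ⊥-elim (ne a)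
  ... | inj₂ (_ , b) = b

  sgn : ∀ {n} → Vec (Fin n) n → ℤ
  sgn v = sign (isEven? v)

  length-filter-allFin≤ : ∀ {n p} {P : Fin n → Set p} (P? : Decidable P) → length (filter P? (allFin n)) ≤ n
  length-filter-allFin≤ {n} P? = ℕP.≤-trans (LP.length-filter P? (allFin n)) (ℕP.≤-reflexive (LP.length-tabulate (λ i → i)))

  cycles≤ : ∀ {n} (v : Vec (Fin n) n) → cycles v ≤ n
  cycles≤ v = length-filter-allFin≤ (cycleMin? v)

  module _ {n : ℕ} (u : Vec (Fin n) n) where
    sgn-extend : sgn (insert u nothing) ≡ sgn u
    sgn-extend = sign-iff (isEven? (insert u nothing)) (isEven? u)
      (λ e → subst (λ c → (suc n ∸ c) % 2 ≡ 0) (cycles-extend u) e)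
      (λ e → subst (λ c → (suc n ∸ c) % 2 ≡ 0) (sym (cycles-extend u)) e)

    sgn-splice : ∀ j → sgn (insert u (just j)) ≡ - sgn u
    sgn-splice j = sign-flip (isEven? (insert u (just j))) (isEven? u)
      (λ e → parity-suc⇒ (n ∸ cycles u) (subst (_≡ 0) (cong (_% 2) eqn) e))
      (λ ne → subst (_≡ 0) (cong (_% 2) (sym eqn)) (parity-suc⇐ (n ∸ cycles u) ne))
      where
      eqn : suc n ∸ cycles (insert u (just j)) ≡ suc (n ∸ cycles u)
      eqn = trans (cong (suc n ∸_) (cycles-splice u j)) (ℕP.+-∸-assoc 1 (cycles≤ u))

  fixedIn? : ∀ {m} (c : ℕ) (v : Vec (Fin m) m) (i : Fin m) → Dec (toℕ i % 2 ≡ c × lookup v i ≡ i)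
  fixedIn? c v i = (toℕ i % 2 ℕ.≟ c) ×-dec (lookup v i ≟ i)

  fixedIn : ∀ {m} (c : ℕ) (v : Vec (Fin m) m) → ℕ
  fixedIn {m} c v = length (filter (fixedIn? c v) (allFin m))

  fixedIn≡∑ : ∀ {m} (c : ℕ) (v : Vec (Fin m) m) → + fixedIn c v ≡ ∑ (allFin m) (λ i → ⟦ fixedIn? c v i ⟧)
  fixedIn≡∑ {m} c v = length-filter≡∑ (fixedIn? c v) (allFin m)

  module _ {n : ℕ} (u : Vec (Fin n) n) (c : ℕ) where
    private s = lookup u

    fixedIn-extend : + fixedIn c (insert u nothing) ≡ + fixedIn c u + ⟦ n % 2 ℕ.≟ c ⟧
    fixedIn-extend = begin
        + fixedIn c (insert u nothing)
      ≡⟨ fixedIn≡∑ c (insert u nothing) ⟩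
        ∑ (allFin (suc n)) (λ i → ⟦ fixedIn? c (insert u nothing) i ⟧)
      ≡⟨ ∑-allFin-last n (λ i → ⟦ fixedIn? c (insert u nothing) i ⟧) ⟩
        ∑ (allFin n) (λ i → ⟦ fixedIn? c (insert u nothing) (old i) ⟧) + ⟦ fixedIn? c (insert u nothing) (new n) ⟧
      ≡⟨ cong₂ _+_ (∑-cong (allFin n) (λ i → ⟦⟧-iff (fixedIn? c (insert u nothing) (old i)) (fixedIn? c u i)
              (λ { (a , b) → trans (cong (_% 2) (sym (toℕ-old i))) a , inject₁-injective (trans (sym (lookup-extend-old u i)) b) })
              (λ { (a , b) → trans (cong (_% 2) (toℕ-old i)) a , trans (lookup-extend-old u i) (cong old b) })))
            (⟦⟧-iff (fixedIn? c (insert u nothing) (new n)) (n % 2 ℕ.≟ c) (λ { (a , b) → trans (cong (_% 2) (sym (toℕ-new n))) a })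
              (λ a → trans (cong (_% 2) (toℕ-new n)) a , lookup-extend-new u)) ⟩
        ∑ (allFin n) (λ i → ⟦ fixedIn? c u i ⟧) + ⟦ n % 2 ℕ.≟ c ⟧
      ≡⟨ cong (_+ ⟦ n % 2 ℕ.≟ c ⟧) (sym (fixedIn≡∑ c u)) ⟩
        + fixedIn c u + ⟦ n % 2 ℕ.≟ c ⟧ ∎
      where open ≡-Reasoning

    fixedIn-splice : ∀ j → + fixedIn c (insert u (just j)) ≡ + fixedIn c u - ⟦ fixedIn? c u j ⟧
    fixedIn-splice j = begin
        + fixedIn c (insert u (just j))
      ≡⟨ fixedIn≡∑ c (insert u (just j)) ⟩
        ∑ (allFin (suc n)) (λ i → ⟦ fixedIn? c (insert u (just j)) i ⟧)
      ≡⟨ ∑-allFin-last n (λ i → ⟦ fixedIn? c (insert u (just j)) i ⟧) ⟩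
        ∑ (allFin n) (λ i → ⟦ fixedIn? c (insert u (just j)) (old i) ⟧) + ⟦ fixedIn? c (insert u (just j)) (new n) ⟧
      ≡⟨ cong₂ _+_ (∑-cong (allFin n) pointwise)
            (⟦⟧-no (fixedIn? c (insert u (just j)) (new n)) (λ { (_ , b) → new≢old (sym (trans (sym (lookup-splice-new u j)) b)) })) ⟩
        ∑ (allFin n) (λ i → ⟦ fixedIn? c u i ⟧ - ⟦ i ≟ j ⟧ * ⟦ fixedIn? c u i ⟧) + 0ℤ
      ≡⟨ trans (+-identityʳ _) (∑-+ (allFin n) (λ i → ⟦ fixedIn? c u i ⟧) (λ i → - (⟦ i ≟ j ⟧ * ⟦ fixedIn? c u i ⟧))) ⟩
        ∑ (allFin n) (λ i → ⟦ fixedIn? c u i ⟧) + ∑ (allFin n) (λ i → - (⟦ i ≟ j ⟧ * ⟦ fixedIn? c u i ⟧))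
      ≡⟨ cong (λ z → ∑ (allFin n) (λ i → ⟦ fixedIn? c u i ⟧) + z)
           (trans (∑-neg (allFin n) (λ i → ⟦ i ≟ j ⟧ * ⟦ fixedIn? c u i ⟧)) (cong -_ (∑-allFin-δ n j (λ i → ⟦ fixedIn? c u i ⟧)))) ⟩
        ∑ (allFin n) (λ i → ⟦ fixedIn? c u i ⟧) - ⟦ fixedIn? c u j ⟧
      ≡⟨ cong (_- ⟦ fixedIn? c u j ⟧) (sym (fixedIn≡∑ c u)) ⟩
        + fixedIn c u - ⟦ fixedIn? c u j ⟧ ∎
      where
      open ≡-Reasoning
      pointwise : ∀ i → ⟦ fixedIn? c (insert u (just j)) (old i) ⟧ ≡ ⟦ fixedIn? c u i ⟧ - ⟦ i ≟ j ⟧ * ⟦ fixedIn? c u i ⟧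
      pointwise i with i ≟ j
      ... | yes refl = trans (⟦⟧-no (fixedIn? c (insert u (just j)) (old i)) (λ { (_ , b) → new≢old (trans (sym (lookup-splice-at u j)) b) }))
                             (sym (trans (cong (λ z → ⟦ fixedIn? c u i ⟧ - z) (*-identityˡ _)) (+-inverseʳ ⟦ fixedIn? c u i ⟧)))
      ... | no ij = trans (⟦⟧-iff (fixedIn? c (insert u (just j)) (old i)) (fixedIn? c u i)
              (λ { (a , b) → trans (cong (_% 2) (sym (toℕ-old i))) a , inject₁-injective (trans (sym (lookup-splice-old u j i ij)) b) })
              (λ { (a , b) → trans (cong (_% 2) (toℕ-old i)) a , trans (lookup-splice-old u j i ij) (cong old b) }))
              (sym (trans (cong (λ z → ⟦ fixedIn? c u i ⟧ - z) (*-zeroˡ ⟦ fixedIn? c u i ⟧)) (+-identityʳ ⟦ fixedIn? c u i ⟧)))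


module InsertionBijection where

  open import Data.Nat as ℕ using (suc)
  open import Data.Integer as ℤ using (ℤ; _*_; -_; _-_)
  open import Data.Integer.Properties hiding (_≟_)
  open import Data.Integer.Tactic.RingSolver
  open import Data.Fin as Fin using (Fin)
  open import Data.Vec using (Vec)
  open import Data.Maybe using (Maybe)
  open import Data.Product using (_×_; _,_)
  open import Relation.Binary.PropositionalEquality
  open import Relation.Nullary
  open import Relation.Nullary.Decidable using (_×-dec_)
  open IndicatorSums
  open InsertRemove

  ⟦×⟧ : ∀ {p q} {P : Set p} {Q : Set q} (a : Dec P) (b : Dec Q) → ⟦ a ×-dec b ⟧ ≡ ⟦ a ⟧ * ⟦ b ⟧
  ⟦×⟧ a b = ⟦⟧-× (a ×-dec b) a b (λ x → x) _,_

  insert-graph : ∀ {n} (u : Vec (Fin n) n) (o : Maybe (Fin n)) (v : Vec (Fin (suc n)) (suc n)) →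
    ⟦ isPerm? u ⟧ * ⟦ v ≟V insert u o ⟧ ≡ ⟦ isPerm? v ⟧ * (⟦ u ≟V removeLast v ⟧ * ⟦ o ≟M position v ⟧)
  insert-graph u o v = trans (sym (⟦×⟧ (isPerm? u) (v ≟V insert u o)))
    (trans (⟦⟧-iff (isPerm? u ×-dec (v ≟V insert u o)) (isPerm? v ×-dec ((u ≟V removeLast v) ×-dec (o ≟M position v))) f g)
    (trans (⟦×⟧ (isPerm? v) ((u ≟V removeLast v) ×-dec (o ≟M position v))) (cong (⟦ isPerm? v ⟧ *_) (⟦×⟧ (u ≟V removeLast v) (o ≟M position v)))))
    where
    f : IsPerm u × v ≡ insert u o → IsPerm v × (u ≡ removeLast v × o ≡ position v)
    f (pu , refl) = insert-perm u o pu , sym (removeLast-insert u o) , sym (position-insert u o)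
    g : IsPerm v × (u ≡ removeLast v × o ≡ position v) → IsPerm u × v ≡ insert u o
    g (pv , refl , refl) = insert-perm⁻ (removeLast v) (position v) (subst IsPerm (sym (insert-removeLast v pv)) pv) , sym (insert-removeLast v pv)

  ∑-perms-by-insertion : ∀ n (h : Vec (Fin (suc n)) (suc n) → ℤ) →
    ∑ (allWords (suc n) (suc n)) (λ v → ⟦ isPerm? v ⟧ * h v) ≡
    ∑ (allWords n n) (λ u → ∑ (allMaybe n) (λ o → ⟦ isPerm? u ⟧ * h (insert u o)))
  ∑-perms-by-insertion n h = sym (begin
      ∑ W (λ u → ∑ (allMaybe n) (λ o → ⟦ isPerm? u ⟧ * h (insert u o)))
    ≡⟨ ∑-cong W (λ u → ∑-cong (allMaybe n) (λ o → cong (⟦ isPerm? u ⟧ *_) (sym (∑-allWords-δ (suc n) (suc n) (insert u o) h)))) ⟩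
      ∑ W (λ u → ∑ (allMaybe n) (λ o → ⟦ isPerm? u ⟧ * ∑ W' (λ v → ⟦ v ≟V insert u o ⟧ * h v)))
    ≡⟨ ∑-cong W (λ u → ∑-cong (allMaybe n) (λ o → trans (sym (∑-* W' ⟦ isPerm? u ⟧ (λ v → ⟦ v ≟V insert u o ⟧ * h v))) (∑-cong W' (λ v → sym (*-assoc ⟦ isPerm? u ⟧ _ _))))) ⟩
      ∑ W (λ u → ∑ (allMaybe n) (λ o → ∑ W' (λ v → (⟦ isPerm? u ⟧ * ⟦ v ≟V insert u o ⟧) * h v)))
    ≡⟨ ∑-cong W (λ u → ∑-swap (allMaybe n) W' (λ o v → (⟦ isPerm? u ⟧ * ⟦ v ≟V insert u o ⟧) * h v)) ⟩
      ∑ W (λ u → ∑ W' (λ v → ∑ (allMaybe n) (λ o → (⟦ isPerm? u ⟧ * ⟦ v ≟V insert u o ⟧) * h v)))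
    ≡⟨ ∑-swap W W' (λ u v → ∑ (allMaybe n) (λ o → (⟦ isPerm? u ⟧ * ⟦ v ≟V insert u o ⟧) * h v)) ⟩
      ∑ W' (λ v → ∑ W (λ u → ∑ (allMaybe n) (λ o → (⟦ isPerm? u ⟧ * ⟦ v ≟V insert u o ⟧) * h v)))
    ≡⟨ ∑-cong W' (λ v → ∑-cong W (λ u → ∑-cong (allMaybe n) (λ o → cong (_* h v) (insert-graph u o v)))) ⟩
      ∑ W' (λ v → ∑ W (λ u → ∑ (allMaybe n) (λ o → (⟦ isPerm? v ⟧ * (⟦ u ≟V removeLast v ⟧ * ⟦ o ≟M position v ⟧)) * h v)))
    ≡⟨ ∑-cong W' (λ v → ∑-cong W (λ u → ∑-cong (allMaybe n) (λ o → by-ring ⟦ isPerm? v ⟧ ⟦ u ≟V removeLast v ⟧ ⟦ o ≟M position v ⟧ (h v)))) ⟩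
      ∑ W' (λ v → ∑ W (λ u → ∑ (allMaybe n) (λ o → ⟦ u ≟V removeLast v ⟧ * (⟦ o ≟M position v ⟧ * (⟦ isPerm? v ⟧ * h v)))))
    ≡⟨ ∑-cong W' (λ v → ∑-cong W (λ u → ∑-* (allMaybe n) ⟦ u ≟V removeLast v ⟧ (λ o → ⟦ o ≟M position v ⟧ * (⟦ isPerm? v ⟧ * h v)))) ⟩
      ∑ W' (λ v → ∑ W (λ u → ⟦ u ≟V removeLast v ⟧ * ∑ (allMaybe n) (λ o → ⟦ o ≟M position v ⟧ * (⟦ isPerm? v ⟧ * h v))))
    ≡⟨ ∑-cong W' (λ v → ∑-allWords-δ n n (removeLast v) (λ u → ∑ (allMaybe n) (λ o → ⟦ o ≟M position v ⟧ * (⟦ isPerm? v ⟧ * h v)))) ⟩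
      ∑ W' (λ v → ∑ (allMaybe n) (λ o → ⟦ o ≟M position v ⟧ * (⟦ isPerm? v ⟧ * h v)))
    ≡⟨ ∑-cong W' (λ v → ∑-allMaybe-δ n (position v) (λ _ → ⟦ isPerm? v ⟧ * h v)) ⟩
      ∑ W' (λ v → ⟦ isPerm? v ⟧ * h v) ∎)
    where
    open ≡-Reasoning
    W = allWords n n
    W' = allWords (suc n) (suc n)
    by-ring : ∀ a b c d → (a * (b * c)) * d ≡ b * (c * (a * d))
    by-ring = solve-∀


module InsertionRecurrence where

  open import Data.Nat as ℕ using (ℕ; zero; suc; _∸_; _%_)
  open import Data.Integer as ℤ using (ℤ; +_; 0ℤ; 1ℤ; _+_; _*_; -_; _-_)
  open import Data.Integer.Properties hiding (_≟_)
  open import Data.Integer.Tactic.RingSolver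
  open import Data.Fin as Fin using (Fin; toℕ)
  open import Data.Fin.Properties using (_≟_)
  open import Data.Vec using (Vec; lookup)
  open import Data.Maybe using (just; nothing)
  open import Data.List using (allFin)
  open import Data.Product using (_×_; _,_)
  open import Relation.Binary.PropositionalEquality
  open import Relation.Nullary
  open IndicatorSums
  open InsertRemove
  open InsertionStatistics
  open InsertionBijection

  +a≡+b-0⇒a≡b : ∀ a b → + a ≡ + b - 0ℤ → a ≡ b
  +a≡+b-0⇒a≡b a b e = +-injective (trans e (+-identityʳ (+ b)))

  +a≡+b-1⇒a≡b∸1 : ∀ a b → + a ≡ + b - 1ℤ → a ≡ b ∸ 1
  +a≡+b-1⇒a≡b∸1 a zero ()
  +a≡+b-1⇒a≡b∸1 a (suc b) e = +-injective (trans e (by-ring (+ b)))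
    where by-ring : ∀ x → (1ℤ + x) - 1ℤ ≡ x
          by-ring = solve-∀

  +a≡+b+0⇒a≡b : ∀ a b → + a ≡ + b + 0ℤ → a ≡ b
  +a≡+b+0⇒a≡b a b e = +-injective (trans e (+-identityʳ (+ b)))

  +a≡+b+1⇒a≡1+b : ∀ a b → + a ≡ + b + 1ℤ → a ≡ suc b
  +a≡+b+1⇒a≡1+b a b e = +-injective (trans e (+-comm (+ b) 1ℤ))

  classCount : ℕ → ℕ → ℤ
  classCount n c = ∑ (allFin n) (λ j → ⟦ toℕ j % 2 ℕ.≟ c ⟧)

  -- n can be appended as a fixed point, or spliced in after any of the S points of its parity
  -- class; the splice removes a fixed point exactly when it follows one of the p fixed points.
  insertionTransfer : ℤ → (ℕ → ℕ → ℤ) → ℕ → ℕ → ℤ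
  insertionTransfer S w p q = w (suc p) q - (+ p * w (p ∸ 1) q + (S - + p) * w p q)

  weightedSign : ∀ {m} (c d : ℕ) (w : ℕ → ℕ → ℤ) → Vec (Fin m) m → ℤ
  weightedSign c d w v = ⟦ parityAlt? v ⟧ * (sgn v * w (fixedIn c v) (fixedIn d v))

  module _ (n c d : ℕ) (nc : n % 2 ≡ c) (dc : d ≢ c) (w : ℕ → ℕ → ℤ) (u : Vec (Fin n) n) where
    private
      p = fixedIn c u
      q = fixedIn d u
      a = ⟦ parityAlt? u ⟧
      sσ = sgn u

    fixedIn-extend-own : fixedIn c (insert u nothing) ≡ suc p
    fixedIn-extend-own = +a≡+b+1⇒a≡1+b _ _ (trans (fixedIn-extend u c) (cong (λ z → + p + z) (⟦⟧-yes (n % 2 ℕ.≟ c) nc)))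

    fixedIn-extend-other : fixedIn d (insert u nothing) ≡ q
    fixedIn-extend-other = +a≡+b+0⇒a≡b _ _ (trans (fixedIn-extend u d) (cong (λ z → + q + z) (⟦⟧-no (n % 2 ℕ.≟ d) (λ e → dc (trans (sym e) nc)))))

    weightedSign-extend : weightedSign c d w (insert u nothing) ≡ a * (sσ * w (suc p) q)
    weightedSign-extend = cong₂ _*_ (⟦⟧-iff (parityAlt? (insert u nothing)) (parityAlt? u) (extend-parityAlt⁻ u) (extend-parityAlt u))
                                    (cong₂ _*_ (sgn-extend u) (cong₂ w fixedIn-extend-own fixedIn-extend-other))

    module _ (j : Fin n) where
      fixedIn-splice-other : toℕ j % 2 ≡ c → fixedIn d (insert u (just j)) ≡ q
      fixedIn-splice-other cj = +a≡+b-0⇒a≡b _ _ (trans (fixedIn-splice u d j) (cong (λ z → + q - z) (⟦⟧-no (fixedIn? d u j) (λ { (e , _) → dc (trans (sym e) cj) }))))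

      fixedIn-splice-fixed : toℕ j % 2 ≡ c → lookup u j ≡ j → fixedIn c (insert u (just j)) ≡ p ∸ 1
      fixedIn-splice-fixed cj fj = +a≡+b-1⇒a≡b∸1 _ p (trans (fixedIn-splice u c j) (cong (λ z → + p - z) (⟦⟧-yes (fixedIn? c u j) (cj , fj))))

      fixedIn-splice-unfixed : lookup u j ≢ j → fixedIn c (insert u (just j)) ≡ p
      fixedIn-splice-unfixed fj = +a≡+b-0⇒a≡b _ p (trans (fixedIn-splice u c j) (cong (λ z → + p - z) (⟦⟧-no (fixedIn? c u j) (λ { (_ , e) → fj e }))))

      -- Splicing n in after j flips the sign, destroys the fixed point j (if any),
      -- and preserves parity alternation iff j has the parity of n.
      weightedSign-splice : weightedSign c d w (insert u (just j)) ≡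
        (a * (- sσ * (w (p ∸ 1) q - w p q))) * ⟦ fixedIn? c u j ⟧ + (a * (- sσ * w p q)) * ⟦ toℕ j % 2 ℕ.≟ c ⟧
      weightedSign-splice = begin
          weightedSign c d w (insert u (just j))
        ≡⟨ cong₂ _*_ (⟦⟧-× (parityAlt? (insert u (just j))) (parityAlt? u) (toℕ j % 2 ℕ.≟ c)
                        (λ P → let (x , y) = splice-parityAlt⁻ u j P in x , trans y nc) (λ x y → splice-parityAlt u j (x , trans y (sym nc))))
                     (cong (_* w c′ d′) (sgn-splice u j)) ⟩
          (a * ⟦ toℕ j % 2 ℕ.≟ c ⟧) * (- sσ * w c′ d′)
        ≡⟨ cases (toℕ j % 2 ℕ.≟ c) (lookup u j ≟ j) ⟩
          (a * (- sσ * (w (p ∸ 1) q - w p q))) * ⟦ fixedIn? c u j ⟧ + (a * (- sσ * w p q)) * ⟦ toℕ j % 2 ℕ.≟ c ⟧ ∎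
        where
        open ≡-Reasoning
        c′ = fixedIn c (insert u (just j))
        d′ = fixedIn d (insert u (just j))
        cases : (cj : Dec (toℕ j % 2 ≡ c)) (fj : Dec (lookup u j ≡ j)) →
          (a * ⟦ cj ⟧) * (- sσ * w c′ d′) ≡ (a * (- sσ * (w (p ∸ 1) q - w p q))) * ⟦ fixedIn? c u j ⟧ + (a * (- sσ * w p q)) * ⟦ cj ⟧
        cases (no ¬cj) fj rewrite ⟦⟧-no (fixedIn? c u j) (λ { (e , _) → ¬cj e }) =
          by-ring₀ a (- sσ * w c′ d′) (a * (- sσ * (w (p ∸ 1) q - w p q))) (a * (- sσ * w p q))
          where by-ring₀ : ∀ x y z t → (x * 0ℤ) * y ≡ z * 0ℤ + t * 0ℤ
                by-ring₀ = solve-∀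
        cases (yes cj) (yes fj) rewrite ⟦⟧-yes (fixedIn? c u j) (cj , fj) | fixedIn-splice-other cj | fixedIn-splice-fixed cj fj =
          by-ring₁ a sσ (w (p ∸ 1) q) (w p q)
          where by-ring₁ : ∀ x y z t → (x * 1ℤ) * (- y * z) ≡ (x * (- y * (z - t))) * 1ℤ + (x * (- y * t)) * 1ℤ
                by-ring₁ = solve-∀
        cases (yes cj) (no fj) rewrite ⟦⟧-no (fixedIn? c u j) (λ { (_ , e) → fj e }) | fixedIn-splice-other cj | fixedIn-splice-unfixed fj =
          by-ring₂ a sσ (w (p ∸ 1) q) (w p q)
          where by-ring₂ : ∀ x y z t → (x * 1ℤ) * (- y * t) ≡ (x * (- y * (z - t))) * 0ℤ + (x * (- y * t)) * 1ℤ
                by-ring₂ = solve-∀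

    ∑-insertions : ∑ (allMaybe n) (λ o → ⟦ isPerm? u ⟧ * weightedSign c d w (insert u o)) ≡
      ⟦ isPerm? u ⟧ * weightedSign c d (insertionTransfer (classCount n c) w) u
    ∑-insertions = begin
        ∑ (allMaybe n) (λ o → ⟦ isPerm? u ⟧ * weightedSign c d w (insert u o))
      ≡⟨ cong (λ z → ⟦ isPerm? u ⟧ * weightedSign c d w (insert u nothing) + z) (∑-map just (allFin n) (λ o → ⟦ isPerm? u ⟧ * weightedSign c d w (insert u o))) ⟩
        ⟦ isPerm? u ⟧ * weightedSign c d w (insert u nothing) + ∑ (allFin n) (λ j → ⟦ isPerm? u ⟧ * weightedSign c d w (insert u (just j)))
      ≡⟨ cong (λ z → ⟦ isPerm? u ⟧ * weightedSign c d w (insert u nothing) + z) (∑-* (allFin n) ⟦ isPerm? u ⟧ (λ j → weightedSign c d w (insert u (just j)))) ⟩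
        ⟦ isPerm? u ⟧ * weightedSign c d w (insert u nothing) + ⟦ isPerm? u ⟧ * ∑ (allFin n) (λ j → weightedSign c d w (insert u (just j)))
      ≡⟨ cong₂ (λ x y → ⟦ isPerm? u ⟧ * x + ⟦ isPerm? u ⟧ * y) weightedSign-extend (∑-cong (allFin n) weightedSign-splice) ⟩
        ⟦ isPerm? u ⟧ * (a * (sσ * w (suc p) q)) + ⟦ isPerm? u ⟧ * ∑ (allFin n) (λ j → k1 * ⟦ fixedIn? c u j ⟧ + k2 * ⟦ toℕ j % 2 ℕ.≟ c ⟧)
      ≡⟨ cong (λ z → ⟦ isPerm? u ⟧ * (a * (sσ * w (suc p) q)) + ⟦ isPerm? u ⟧ * z)
           (trans (∑-+ (allFin n) (λ j → k1 * ⟦ fixedIn? c u j ⟧) (λ j → k2 * ⟦ toℕ j % 2 ℕ.≟ c ⟧))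
             (cong₂ _+_ (trans (∑-* (allFin n) k1 (λ j → ⟦ fixedIn? c u j ⟧)) (cong (k1 *_) (sym (fixedIn≡∑ c u)))) (∑-* (allFin n) k2 (λ j → ⟦ toℕ j % 2 ℕ.≟ c ⟧)))) ⟩
        ⟦ isPerm? u ⟧ * (a * (sσ * w (suc p) q)) + ⟦ isPerm? u ⟧ * (k1 * + p + k2 * classCount n c)
      ≡⟨ by-ring ⟦ isPerm? u ⟧ a sσ (w (suc p) q) (w (p ∸ 1) q) (w p q) (+ p) (classCount n c) ⟩
        ⟦ isPerm? u ⟧ * (a * (sσ * (w (suc p) q - (+ p * w (p ∸ 1) q + (classCount n c - + p) * w p q)))) ∎
      where
      open ≡-Reasoning
      k1 = a * (- sσ * (w (p ∸ 1) q - w p q))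
      k2 = a * (- sσ * w p q)
      by-ring : ∀ e a sσ W2 W1 W0 P s → e * (a * (sσ * W2)) + e * ((a * (- sσ * (W1 - W0))) * P + (a * (- sσ * W0)) * s) ≡ e * (a * (sσ * (W2 - (P * W1 + (s - P) * W0))))
      by-ring = solve-∀

  weightedSign-recurrence : ∀ n c d → n % 2 ≡ c → d ≢ c → (w : ℕ → ℕ → ℤ) →
    ∑ (allWords (suc n) (suc n)) (λ v → ⟦ isPerm? v ⟧ * weightedSign c d w v) ≡
    ∑ (allWords n n) (λ u → ⟦ isPerm? u ⟧ * weightedSign c d (insertionTransfer (classCount n c) w) u)
  weightedSign-recurrence n c d nc dc w = trans (∑-perms-by-insertion n (weightedSign c d w)) (∑-cong (allWords n n) (∑-insertions n c d nc dc w))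


module Binomial where

  open import Data.Nat as ℕ using (ℕ; zero; suc; _∸_; _<_; _≤_; s≤s)
  import Data.Nat.Properties as ℕP
  open import Data.Integer as ℤ using (ℤ; +_; 0ℤ; 1ℤ; _+_; _*_; -_; _-_)
  open import Data.Integer.Properties hiding (_≟_)
  open import Data.Integer.Tactic.RingSolver
  open import Relation.Binary.PropositionalEquality
  open import Relation.Nullary
  open import Data.Empty using (⊥-elim)
  open IndicatorSums
  open import Data.List using (List; map; allFin)
  open import Data.Fin as Fin using (toℕ; fromℕ<; inject₁; fromℕ)
  open import Data.Fin.Properties using (toℕ-inject₁; toℕ-fromℕ; toℕ-fromℕ<; toℕ-injective) renaming (_≟_ to _≟F_)

  -- Unlike Data.Nat.Combinatorics._C_, this binomial coefficient computes by Pascal's rule.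
  choose : ℕ → ℕ → ℕ
  choose p zero = 1
  choose zero (suc r) = 0
  choose (suc p) (suc r) = choose p r ℕ.+ choose p (suc r)

  Cℤ : ℕ → ℕ → ℤ
  Cℤ p r = + choose p r

  Cℤ-prev : ℕ → ℕ → ℤ
  Cℤ-prev p zero = 0ℤ
  Cℤ-prev p (suc r) = Cℤ p r

  choose-1 : ∀ p → choose p 1 ≡ p
  choose-1 zero = refl
  choose-1 (suc p) = cong suc (choose-1 p)

  choose-absorb : ∀ p r → suc r ℕ.* choose (suc p) (suc r) ≡ suc p ℕ.* choose p r
  choose-absorb zero zero = refl
  choose-absorb zero (suc r) = ℕP.*-zeroʳ (suc (suc r))
  choose-absorb (suc p) zero = trans (ℕP.*-identityˡ _) (trans (choose-1 (suc (suc p))) (sym (ℕP.*-identityʳ _)))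
  choose-absorb (suc p) (suc r) = +-injective (begin
      + (suc (suc r) ℕ.* choose (suc (suc p)) (suc (suc r)))
    ≡⟨ trans (pos-* (suc (suc r)) (choose (suc (suc p)) (suc (suc r)))) (cong (+ suc (suc r) *_) (pos-+ (choose (suc p) (suc r)) (choose (suc p) (suc (suc r))))) ⟩
      + suc (suc r) * (+ choose (suc p) (suc r) + + choose (suc p) (suc (suc r)))
    ≡⟨ by-ring (+ r) (+ choose (suc p) (suc r)) (+ choose (suc p) (suc (suc r))) ⟩
      (+ suc r * + choose (suc p) (suc r) + + choose (suc p) (suc r)) + + suc (suc r) * + choose (suc p) (suc (suc r))
    ≡⟨ cong₂ (λ x y → (x + + choose (suc p) (suc r)) + y) (trans (sym (pos-* (suc r) (choose (suc p) (suc r)))) (trans (cong +_ (choose-absorb p r)) (pos-* (suc p) (choose p r))))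
                                                            (trans (sym (pos-* (suc (suc r)) (choose (suc p) (suc (suc r))))) (trans (cong +_ (choose-absorb p (suc r))) (pos-* (suc p) (choose p (suc r))))) ⟩
      (+ suc p * + choose p r + + choose (suc p) (suc r)) + + suc p * + choose p (suc r)
    ≡⟨ by-ring′ (+ p) (+ choose p r) (+ choose p (suc r)) ⟩
      + suc (suc p) * (+ choose p r + + choose p (suc r))
    ≡⟨ sym (trans (pos-* (suc (suc p)) (choose (suc p) (suc r))) (cong (+ suc (suc p) *_) (pos-+ (choose p r) (choose p (suc r))))) ⟩
      + (suc (suc p) ℕ.* choose (suc p) (suc r)) ∎)
    where
    open ≡-Reasoning
    by-ring : ∀ r x y → (1ℤ + (1ℤ + r)) * (x + y) ≡ ((1ℤ + r) * x + x) + (1ℤ + (1ℤ + r)) * y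
    by-ring = solve-∀
    by-ring′ : ∀ p x y → ((1ℤ + p) * x + (x + y)) + (1ℤ + p) * y ≡ (1ℤ + (1ℤ + p)) * (x + y)
    by-ring′ = solve-∀

  Cℤ-absorb : ∀ p r → + suc r * Cℤ (suc p) (suc r) ≡ + suc p * Cℤ p r
  Cℤ-absorb p r = trans (sym (pos-* (suc r) (choose (suc p) (suc r)))) (trans (cong +_ (choose-absorb p r)) (pos-* (suc p) (choose p r)))

  Cℤ-pred-absorb : ∀ p r → + p * Cℤ (p ∸ 1) r ≡ + suc r * Cℤ p (suc r)
  Cℤ-pred-absorb zero r = sym (*-zeroʳ (+ suc r))
  Cℤ-pred-absorb (suc p) r = sym (Cℤ-absorb p r)

  Cℤ-split : ∀ p r → + p * Cℤ p r ≡ + suc r * Cℤ p (suc r) + + r * Cℤ p r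
  Cℤ-split p r = begin
      + p * Cℤ p r
    ≡⟨ by-ring (+ p) (Cℤ p r) ⟩
      + suc p * Cℤ p r - Cℤ p r
    ≡⟨ cong (_- Cℤ p r) (sym (Cℤ-absorb p r)) ⟩
      + suc r * Cℤ (suc p) (suc r) - Cℤ p r
    ≡⟨ cong (λ z → + suc r * z - Cℤ p r) (pos-+ (choose p r) (choose p (suc r))) ⟩
      + suc r * (Cℤ p r + Cℤ p (suc r)) - Cℤ p r
    ≡⟨ by-ring′ (+ r) (Cℤ p r) (Cℤ p (suc r)) ⟩
      + suc r * Cℤ p (suc r) + + r * Cℤ p r ∎
    where
    open ≡-Reasoning
    by-ring : ∀ p x → p * x ≡ (1ℤ + p) * x - x
    by-ring = solve-∀
    by-ring′ : ∀ r x y → (1ℤ + r) * (x + y) - x ≡ (1ℤ + r) * y + r * x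
    by-ring′ = solve-∀

  Cℤ-pascal : ∀ p r → Cℤ (suc p) r ≡ Cℤ p r + Cℤ-prev p r
  Cℤ-pascal p zero = refl
  Cℤ-pascal p (suc r) = trans (pos-+ (choose p r) (choose p (suc r))) (+-comm (Cℤ p r) (Cℤ p (suc r)))

  Cℤ-insertion-identity : ∀ p r (s : ℤ) → Cℤ (suc p) r - (+ p * Cℤ (p ∸ 1) r + (s - + p) * Cℤ p r) ≡ (1ℤ - s + + r) * Cℤ p r + Cℤ-prev p r
  Cℤ-insertion-identity p r s = begin
      Cℤ (suc p) r - (+ p * Cℤ (p ∸ 1) r + (s - + p) * Cℤ p r)
    ≡⟨ cong₂ (λ x y → x - (y + (s - + p) * Cℤ p r)) (Cℤ-pascal p r) (Cℤ-pred-absorb p r) ⟩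
      (Cℤ p r + Cℤ-prev p r) - (+ suc r * Cℤ p (suc r) + (s - + p) * Cℤ p r)
    ≡⟨ by-ring (Cℤ p r) (Cℤ-prev p r) (+ suc r * Cℤ p (suc r)) s (+ p) ⟩
      (Cℤ p r + Cℤ-prev p r) - (+ suc r * Cℤ p (suc r) + (s * Cℤ p r - + p * Cℤ p r))
    ≡⟨ cong (λ z → (Cℤ p r + Cℤ-prev p r) - (+ suc r * Cℤ p (suc r) + (s * Cℤ p r - z))) (Cℤ-split p r) ⟩
      (Cℤ p r + Cℤ-prev p r) - (+ suc r * Cℤ p (suc r) + (s * Cℤ p r - (+ suc r * Cℤ p (suc r) + + r * Cℤ p r)))
    ≡⟨ by-ring′ (Cℤ p r) (Cℤ-prev p r) (+ suc r * Cℤ p (suc r)) s (+ r) ⟩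
      (1ℤ - s + + r) * Cℤ p r + Cℤ-prev p r ∎
    where
    open ≡-Reasoning
    by-ring : ∀ b bp t s P → (b + bp) - (t + (s - P) * b) ≡ (b + bp) - (t + (s * b - P * b))
    by-ring = solve-∀
    by-ring′ : ∀ b bp t s r → (b + bp) - (t + (s * b - (t + r * b))) ≡ (1ℤ - s + r) * b + bp
    by-ring′ = solve-∀

  -- Φ s r = Σ_σ sgn σ · C(fix σ, r) over the permutations σ of an s-set: grouping by the chosen
  -- r fixed points, the signs cancel unless at most one point is left over.
  Φ : ℕ → ℕ → ℤ
  Φ s r = ⟦ r ℕ.≟ s ⟧ + + s * ⟦ suc r ℕ.≟ s ⟧

  Φ-prev : ℕ → ℕ → ℤ
  Φ-prev s zero = 0ℤ
  Φ-prev s (suc r) = Φ s r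

  ⟦suc≟suc⟧ : ∀ a b → ⟦ suc a ℕ.≟ suc b ⟧ ≡ ⟦ a ℕ.≟ b ⟧
  ⟦suc≟suc⟧ a b = ⟦⟧-iff (suc a ℕ.≟ suc b) (a ℕ.≟ b) ℕP.suc-injective (cong suc)

  Φ-step : ∀ s r → ⟦ suc r ℕ.≟ s ⟧ ≡ (1ℤ - + s + + suc r) * (⟦ suc r ℕ.≟ s ⟧ + + s * ⟦ suc (suc r) ℕ.≟ s ⟧)
  Φ-step s r with suc r ℕ.≟ s | suc (suc r) ℕ.≟ s
  ... | yes refl | yes e = ⊥-elim (ℕP.1+n≢n e)
  ... | yes refl | no _ = by-ring₁ (+ r)
    where by-ring₁ : ∀ r → 1ℤ ≡ (1ℤ - (1ℤ + r) + (1ℤ + r)) * (1ℤ + (1ℤ + r) * 0ℤ)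
          by-ring₁ = solve-∀
  ... | no _ | yes refl = by-ring₂ (+ r)
    where by-ring₂ : ∀ r → 0ℤ ≡ (1ℤ - (1ℤ + (1ℤ + r)) + (1ℤ + r)) * (0ℤ + (1ℤ + (1ℤ + r)) * 1ℤ)
          by-ring₂ = solve-∀
  ... | no _ | no _ = by-ring₃ (1ℤ - + s + + suc r) (+ s)
    where by-ring₃ : ∀ a b → 0ℤ ≡ a * (0ℤ + b * 0ℤ)
          by-ring₃ = solve-∀

  Φ-recurrence : ∀ s r → Φ (suc s) r ≡ (1ℤ - + s + + r) * Φ s r + Φ-prev s r
  Φ-recurrence zero zero = refl
  Φ-recurrence (suc zero) zero = refl
  Φ-recurrence (suc (suc s)) zero = by-ring (+ s)
    where by-ring : ∀ s → 0ℤ + (1ℤ + (1ℤ + (1ℤ + s))) * 0ℤ ≡ (1ℤ - (1ℤ + (1ℤ + s)) + 0ℤ) * (0ℤ + (1ℤ + (1ℤ + s)) * 0ℤ) + 0ℤ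
          by-ring = solve-∀
  Φ-recurrence s (suc r) = begin
      ⟦ suc r ℕ.≟ suc s ⟧ + + suc s * ⟦ suc (suc r) ℕ.≟ suc s ⟧
    ≡⟨ cong₂ (λ x y → x + + suc s * y) (⟦suc≟suc⟧ r s) (⟦suc≟suc⟧ (suc r) s) ⟩
      ⟦ r ℕ.≟ s ⟧ + + suc s * ⟦ suc r ℕ.≟ s ⟧
    ≡⟨ by-ring₁ ⟦ r ℕ.≟ s ⟧ (+ s) ⟦ suc r ℕ.≟ s ⟧ ⟩
      (⟦ r ℕ.≟ s ⟧ + + s * ⟦ suc r ℕ.≟ s ⟧) + ⟦ suc r ℕ.≟ s ⟧
    ≡⟨ cong (λ z → (⟦ r ℕ.≟ s ⟧ + + s * ⟦ suc r ℕ.≟ s ⟧) + z) (Φ-step s r) ⟩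
      (⟦ r ℕ.≟ s ⟧ + + s * ⟦ suc r ℕ.≟ s ⟧) + (1ℤ - + s + + suc r) * (⟦ suc r ℕ.≟ s ⟧ + + s * ⟦ suc (suc r) ℕ.≟ s ⟧)
    ≡⟨ +-comm (Φ s r) ((1ℤ - + s + + suc r) * Φ s (suc r)) ⟩
      (1ℤ - + s + + suc r) * Φ s (suc r) + Φ s r ∎
    where
    open ≡-Reasoning
    by-ring₁ : ∀ x s y → x + (1ℤ + s) * y ≡ (x + s * y) + y
    by-ring₁ = solve-∀


  range : ℕ → List ℕ
  range N = map toℕ (allFin (suc N))

  ∑-range : ∀ N f → ∑ (range N) f ≡ ∑ (allFin (suc N)) (λ i → f (toℕ i))
  ∑-range N f = ∑-map toℕ (allFin (suc N)) f

  ∑-range-snoc : ∀ N f → ∑ (range (suc N)) f ≡ ∑ (range N) f + f (suc N)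
  ∑-range-snoc N f = begin
      ∑ (range (suc N)) f
    ≡⟨ ∑-range (suc N) f ⟩
      ∑ (allFin (suc (suc N))) (λ i → f (toℕ i))
    ≡⟨ ∑-allFin-last (suc N) (λ i → f (toℕ i)) ⟩
      ∑ (allFin (suc N)) (λ i → f (toℕ (inject₁ i))) + f (toℕ (fromℕ (suc N)))
    ≡⟨ cong₂ _+_ (∑-cong (allFin (suc N)) (λ i → cong f (toℕ-inject₁ i))) (cong f (toℕ-fromℕ (suc N))) ⟩
      ∑ (allFin (suc N)) (λ i → f (toℕ i)) + f (suc N)
    ≡⟨ cong (_+ f (suc N)) (sym (∑-range N f)) ⟩
      ∑ (range N) f + f (suc N) ∎
    where open ≡-Reasoning

  ∑-range-δ : ∀ N t (f : ℕ → ℤ) → t ≤ N → ∑ (range N) (λ r → ⟦ r ℕ.≟ t ⟧ * f r) ≡ f t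
  ∑-range-δ N t f t≤N = begin
      ∑ (range N) (λ r → ⟦ r ℕ.≟ t ⟧ * f r)
    ≡⟨ ∑-range N (λ r → ⟦ r ℕ.≟ t ⟧ * f r) ⟩
      ∑ (allFin (suc N)) (λ i → ⟦ toℕ i ℕ.≟ t ⟧ * f (toℕ i))
    ≡⟨ ∑-cong (allFin (suc N)) (λ i → cong (_* f (toℕ i)) (⟦⟧-iff (toℕ i ℕ.≟ t) (i ≟F t′)
         (λ e → toℕ-injective (trans e (sym toℕ-t′))) (λ e → trans (cong toℕ e) toℕ-t′))) ⟩
      ∑ (allFin (suc N)) (λ i → ⟦ i ≟F t′ ⟧ * f (toℕ i))
    ≡⟨ ∑-allFin-δ (suc N) t′ (λ i → f (toℕ i)) ⟩
      f (toℕ t′)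
    ≡⟨ cong f toℕ-t′ ⟩
      f t ∎
    where
    open ≡-Reasoning
    t′ = fromℕ< (s≤s t≤N)
    toℕ-t′ : toℕ t′ ≡ t
    toℕ-t′ = toℕ-fromℕ< (s≤s t≤N)

  neg1^ : ℕ → ℤ
  neg1^ zero = 1ℤ
  neg1^ (suc r) = - neg1^ r

  choose-0 : ∀ p r → p < r → choose p r ≡ 0
  choose-0 zero (suc r) _ = refl
  choose-0 (suc p) (suc r) (s≤s p<r) = cong₂ ℕ._+_ (choose-0 p r p<r) (choose-0 p (suc r) (ℕP.m<n⇒m<1+n p<r))

  ∑-alternating-choose-suc : ∀ p N → ∑ (range N) (λ r → neg1^ r * Cℤ (suc p) r) ≡ neg1^ N * Cℤ p N
  ∑-alternating-choose-suc p zero = refl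
  ∑-alternating-choose-suc p (suc N) = begin
      ∑ (range (suc N)) (λ r → neg1^ r * Cℤ (suc p) r)
    ≡⟨ ∑-range-snoc N (λ r → neg1^ r * Cℤ (suc p) r) ⟩
      ∑ (range N) (λ r → neg1^ r * Cℤ (suc p) r) + - neg1^ N * Cℤ (suc p) (suc N)
    ≡⟨ cong₂ (λ x y → x + - neg1^ N * y) (∑-alternating-choose-suc p N) (pos-+ (choose p N) (choose p (suc N))) ⟩
      neg1^ N * Cℤ p N + - neg1^ N * (Cℤ p N + Cℤ p (suc N))
    ≡⟨ by-ring (neg1^ N) (Cℤ p N) (Cℤ p (suc N)) ⟩
      - neg1^ N * Cℤ p (suc N) ∎
    where
    open ≡-Reasoning
    by-ring : ∀ a x y → a * x + - a * (x + y) ≡ - a * y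
    by-ring = solve-∀

  ∑-alternating-choose-0 : ∀ N → ∑ (range N) (λ r → neg1^ r * Cℤ 0 r) ≡ 1ℤ
  ∑-alternating-choose-0 zero = refl
  ∑-alternating-choose-0 (suc N) = trans (∑-range-snoc N (λ r → neg1^ r * Cℤ 0 r)) (trans (cong₂ _+_ (∑-alternating-choose-0 N) (*-zeroʳ (- neg1^ N))) (+-identityʳ 1ℤ))

  ∑-alternating-choose : ∀ p N → p ≤ N → ∑ (range N) (λ r → neg1^ r * Cℤ p r) ≡ ⟦ p ℕ.≟ 0 ⟧
  ∑-alternating-choose zero N _ = ∑-alternating-choose-0 N
  ∑-alternating-choose (suc p) N p<N = trans (∑-alternating-choose-suc p N) (trans (cong (λ z → neg1^ N * + z) (choose-0 p N p<N)) (*-zeroʳ (neg1^ N)))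

  -- The number of even minus odd derangements of an s-set (see ∑-alternating-Φ).
  ψ : ℕ → ℤ
  ψ zero = 1ℤ
  ψ (suc s) = neg1^ s * + s

  ∑-alternating-Φ : ∀ s N → s ≤ N → ∑ (range N) (λ r → neg1^ r * Φ s r) ≡ ψ s
  ∑-alternating-Φ s N s≤N = begin
      ∑ (range N) (λ r → neg1^ r * Φ s r)
    ≡⟨ ∑-cong (range N) (λ r → by-ring (neg1^ r) ⟦ r ℕ.≟ s ⟧ (+ s) ⟦ suc r ℕ.≟ s ⟧) ⟩
      ∑ (range N) (λ r → ⟦ r ℕ.≟ s ⟧ * neg1^ r + + s * (⟦ suc r ℕ.≟ s ⟧ * neg1^ r))
    ≡⟨ ∑-+ (range N) (λ r → ⟦ r ℕ.≟ s ⟧ * neg1^ r) (λ r → + s * (⟦ suc r ℕ.≟ s ⟧ * neg1^ r)) ⟩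
      ∑ (range N) (λ r → ⟦ r ℕ.≟ s ⟧ * neg1^ r) + ∑ (range N) (λ r → + s * (⟦ suc r ℕ.≟ s ⟧ * neg1^ r))
    ≡⟨ cong₂ _+_ (∑-range-δ N s neg1^ s≤N) (∑-* (range N) (+ s) (λ r → ⟦ suc r ℕ.≟ s ⟧ * neg1^ r)) ⟩
      neg1^ s + + s * ∑ (range N) (λ r → ⟦ suc r ℕ.≟ s ⟧ * neg1^ r)
    ≡⟨ close s s≤N ⟩
      ψ s ∎
    where
    open ≡-Reasoning
    by-ring : ∀ a x s y → a * (x + s * y) ≡ x * a + s * (y * a)
    by-ring = solve-∀
    close : ∀ s → s ≤ N → neg1^ s + + s * ∑ (range N) (λ r → ⟦ suc r ℕ.≟ s ⟧ * neg1^ r) ≡ ψ s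
    close zero _ = refl
    close (suc s) s<N = trans (cong (λ z → - neg1^ s + + suc s * z) shifted-δ) (by-ring₂ (neg1^ s) (+ s))
      where
      shifted-δ : ∑ (range N) (λ r → ⟦ suc r ℕ.≟ suc s ⟧ * neg1^ r) ≡ neg1^ s
      shifted-δ = trans (∑-cong (range N) (λ r → cong (_* neg1^ r) (⟦suc≟suc⟧ r s))) (∑-range-δ N s neg1^ (ℕP.<⇒≤ s<N))
      by-ring₂ : ∀ a s → - a + (1ℤ + s) * a ≡ a * s
      by-ring₂ = solve-∀


module WeightedSignedCount where

  open import Data.Nat as ℕ using (ℕ; zero; suc; _∸_; _%_; _≤_)
  import Data.Nat.Properties as ℕP
  open import Data.Integer as ℤ using (ℤ; +_; 0ℤ; 1ℤ; _+_; _*_; -_; _-_)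
  open import Data.Integer.Properties hiding (_≟_)
  open import Data.Integer.Tactic.RingSolver
  open import Data.Fin as Fin using (Fin; toℕ; inject₁; fromℕ)
  open import Data.Fin.Properties using (toℕ-inject₁; toℕ-fromℕ)
  open import Data.Vec using (Vec)
  open import Data.List using (List; allFin)
  open import Data.Product using (_×_; _,_; proj₁; proj₂)
  open import Data.Sum using (inj₁; inj₂)
  open import Relation.Binary.PropositionalEquality
  open import Relation.Nullary
  open IndicatorSums
  open InsertionStatistics
  open InsertionRecurrence
  open Binomial

  ind : ∀ {p} {P : Set p} → Dec P → ℕ
  ind (yes _) = 1
  ind (no _) = 0

  ⟦⟧ind : ∀ {p} {P : Set p} (d : Dec P) → ⟦ d ⟧ ≡ + ind d
  ⟦⟧ind (yes _) = refl
  ⟦⟧ind (no _) = refl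

  classSize : ℕ → ℕ → ℕ
  classSize zero c = 0
  classSize (suc n) c = classSize n c ℕ.+ ind (n % 2 ℕ.≟ c)

  classCount≡classSize : ∀ n c → classCount n c ≡ + classSize n c
  classCount≡classSize zero c = refl
  classCount≡classSize (suc n) c = begin
      classCount (suc n) c
    ≡⟨ ∑-allFin-last n (λ j → ⟦ toℕ j % 2 ℕ.≟ c ⟧) ⟩
      ∑ (allFin n) (λ j → ⟦ toℕ (inject₁ j) % 2 ℕ.≟ c ⟧) + ⟦ toℕ (fromℕ n) % 2 ℕ.≟ c ⟧
    ≡⟨ cong₂ _+_ (∑-cong (allFin n) (λ j → cong (λ z → ⟦ z % 2 ℕ.≟ c ⟧) (toℕ-inject₁ j))) (cong (λ z → ⟦ z % 2 ℕ.≟ c ⟧) (toℕ-fromℕ n)) ⟩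
      classCount n c + ⟦ n % 2 ℕ.≟ c ⟧
    ≡⟨ cong₂ _+_ (classCount≡classSize n c) (⟦⟧ind (n % 2 ℕ.≟ c)) ⟩
      + classSize n c + + ind (n % 2 ℕ.≟ c)
    ≡⟨ sym (pos-+ (classSize n c) (ind (n % 2 ℕ.≟ c))) ⟩
      + classSize (suc n) c ∎
    where open ≡-Reasoning

  signedPAPSum : ∀ n → (Vec (Fin n) n → ℤ) → ℤ
  signedPAPSum n g = ∑ (allWords n n) (λ v → ⟦ isPerm? v ⟧ * (⟦ parityAlt? v ⟧ * (sgn v * g v)))

  signedPAPSum-cong : ∀ n {g h : Vec (Fin n) n → ℤ} → (∀ v → g v ≡ h v) → signedPAPSum n g ≡ signedPAPSum n h
  signedPAPSum-cong n e = ∑-cong (allWords n n) (λ v → cong (λ z → ⟦ isPerm? v ⟧ * (⟦ parityAlt? v ⟧ * (sgn v * z))) (e v))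

  signedPAPSum-linear : ∀ n (k : ℤ) (g h : Vec (Fin n) n → ℤ) → signedPAPSum n (λ v → k * g v + h v) ≡ k * signedPAPSum n g + signedPAPSum n h
  signedPAPSum-linear n k g h = begin
      signedPAPSum n (λ v → k * g v + h v)
    ≡⟨ ∑-cong (allWords n n) (λ v → by-ring ⟦ isPerm? v ⟧ ⟦ parityAlt? v ⟧ (sgn v) k (g v) (h v)) ⟩
      ∑ (allWords n n) (λ v → k * term g v + term h v)
    ≡⟨ ∑-+ (allWords n n) (λ v → k * term g v) (term h) ⟩
      ∑ (allWords n n) (λ v → k * term g v) + signedPAPSum n h
    ≡⟨ cong (_+ signedPAPSum n h) (∑-* (allWords n n) k (term g)) ⟩
      k * signedPAPSum n g + signedPAPSum n h ∎
    where
    open ≡-Reasoning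
    term : (Vec (Fin n) n → ℤ) → Vec (Fin n) n → ℤ
    term f v = ⟦ isPerm? v ⟧ * (⟦ parityAlt? v ⟧ * (sgn v * f v))
    by-ring : ∀ a b s k x y → a * (b * (s * (k * x + y))) ≡ k * (a * (b * (s * x))) + a * (b * (s * y))
    by-ring = solve-∀

  signedPAPSum-* : ∀ n (k : ℤ) (g : Vec (Fin n) n → ℤ) → signedPAPSum n (λ v → k * g v) ≡ k * signedPAPSum n g
  signedPAPSum-* n k g = trans (∑-cong (allWords n n) (λ v → by-ring ⟦ isPerm? v ⟧ ⟦ parityAlt? v ⟧ (sgn v) k (g v))) (∑-* (allWords n n) k _)
    where by-ring : ∀ a b s k x → a * (b * (s * (k * x))) ≡ k * (a * (b * (s * x)))
          by-ring = solve-∀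

  signedPAPSum-∑ : ∀ {a} {A : Set a} n (xs : List A) (f : A → Vec (Fin n) n → ℤ) → signedPAPSum n (λ v → ∑ xs (λ x → f x v)) ≡ ∑ xs (λ x → signedPAPSum n (f x))
  signedPAPSum-∑ n xs f = trans (∑-cong (allWords n n) (λ v → trans (cong (λ z → ⟦ isPerm? v ⟧ * (⟦ parityAlt? v ⟧ * z)) (sym (∑-* xs (sgn v) (λ x → f x v))))
                        (trans (cong (λ z → ⟦ isPerm? v ⟧ * z) (sym (∑-* xs ⟦ parityAlt? v ⟧ _))) (sym (∑-* xs ⟦ isPerm? v ⟧ _)))))
                (∑-swap (allWords n n) xs _)

  classSize≤ : ∀ n c → classSize n c ≤ n
  classSize≤ zero c = ℕ.z≤n
  classSize≤ (suc n) c = ℕP.≤-trans (ℕP.+-mono-≤ (classSize≤ n c) (ind≤ (n % 2 ℕ.≟ c))) (ℕP.≤-reflexive (ℕP.+-comm n 1))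
    where ind≤ : ∀ {p} {P : Set p} (d : Dec P) → ind d ≤ 1
          ind≤ (yes _) = ℕP.≤-refl
          ind≤ (no _) = ℕ.z≤n

  weightedCount : ℕ → ℕ → ℕ → ℤ
  weightedCount n r0 r1 = signedPAPSum n (λ v → Cℤ (fixedIn 0 v) r0 * Cℤ (fixedIn 1 v) r1)

  weightedCount-prev₀ : ℕ → ℕ → ℕ → ℤ
  weightedCount-prev₀ n zero r1 = 0ℤ
  weightedCount-prev₀ n (suc r0) r1 = weightedCount n r0 r1

  weightedCount-prev₁ : ℕ → ℕ → ℕ → ℤ
  weightedCount-prev₁ n r0 zero = 0ℤ
  weightedCount-prev₁ n r0 (suc r1) = weightedCount n r0 r1

  signedPAPSum-0 : ∀ n → signedPAPSum n (λ _ → 0ℤ) ≡ 0ℤ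
  signedPAPSum-0 n = ∑-zero (allWords n n) _ (λ v → by-ring ⟦ isPerm? v ⟧ ⟦ parityAlt? v ⟧ (sgn v))
    where by-ring : ∀ a b s → a * (b * (s * 0ℤ)) ≡ 0ℤ
          by-ring = solve-∀

  signedPAPSum-prev₀ : ∀ n r0 r1 → signedPAPSum n (λ v → Cℤ-prev (fixedIn 0 v) r0 * Cℤ (fixedIn 1 v) r1) ≡ weightedCount-prev₀ n r0 r1
  signedPAPSum-prev₀ n zero r1 = trans (signedPAPSum-cong n (λ v → *-zeroˡ (Cℤ (fixedIn 1 v) r1))) (signedPAPSum-0 n)
  signedPAPSum-prev₀ n (suc r0) r1 = refl

  signedPAPSum-prev₁ : ∀ n r0 r1 → signedPAPSum n (λ v → Cℤ (fixedIn 0 v) r0 * Cℤ-prev (fixedIn 1 v) r1) ≡ weightedCount-prev₁ n r0 r1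
  signedPAPSum-prev₁ n r0 zero = trans (signedPAPSum-cong n (λ v → *-zeroʳ (Cℤ (fixedIn 0 v) r0))) (signedPAPSum-0 n)
  signedPAPSum-prev₁ n r0 (suc r1) = refl

  weightedCount-step₀ : ∀ n r0 r1 → n % 2 ≡ 0 → weightedCount (suc n) r0 r1 ≡ (1ℤ - + classSize n 0 + + r0) * weightedCount n r0 r1 + weightedCount-prev₀ n r0 r1
  weightedCount-step₀ n r0 r1 nc = begin
      weightedCount (suc n) r0 r1
    ≡⟨ weightedSign-recurrence n 0 1 nc (λ ()) (λ x y → Cℤ x r0 * Cℤ y r1) ⟩
      signedPAPSum n (λ u → insertionTransfer (classCount n 0) (λ x y → Cℤ x r0 * Cℤ y r1) (fixedIn 0 u) (fixedIn 1 u))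
    ≡⟨ signedPAPSum-cong n (λ u → binomial-step (fixedIn 0 u) (fixedIn 1 u)) ⟩
      signedPAPSum n (λ u → (1ℤ - + classSize n 0 + + r0) * (Cℤ (fixedIn 0 u) r0 * Cℤ (fixedIn 1 u) r1) + Cℤ-prev (fixedIn 0 u) r0 * Cℤ (fixedIn 1 u) r1)
    ≡⟨ signedPAPSum-linear n (1ℤ - + classSize n 0 + + r0) (λ u → Cℤ (fixedIn 0 u) r0 * Cℤ (fixedIn 1 u) r1) (λ u → Cℤ-prev (fixedIn 0 u) r0 * Cℤ (fixedIn 1 u) r1) ⟩
      (1ℤ - + classSize n 0 + + r0) * weightedCount n r0 r1 + signedPAPSum n (λ u → Cℤ-prev (fixedIn 0 u) r0 * Cℤ (fixedIn 1 u) r1)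
    ≡⟨ cong (λ z → (1ℤ - + classSize n 0 + + r0) * weightedCount n r0 r1 + z) (signedPAPSum-prev₀ n r0 r1) ⟩
      (1ℤ - + classSize n 0 + + r0) * weightedCount n r0 r1 + weightedCount-prev₀ n r0 r1 ∎
    where
    open ≡-Reasoning
    binomial-step : ∀ p q → insertionTransfer (classCount n 0) (λ x y → Cℤ x r0 * Cℤ y r1) p q ≡
      (1ℤ - + classSize n 0 + + r0) * (Cℤ p r0 * Cℤ q r1) + Cℤ-prev p r0 * Cℤ q r1
    binomial-step p q = trans (by-ring (Cℤ (suc p) r0) (Cℤ q r1) (+ p) (Cℤ (p ∸ 1) r0) (classCount n 0) (Cℤ p r0))
             (trans (cong (_* Cℤ q r1) (Cℤ-insertion-identity p r0 (classCount n 0)))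
             (trans (cong (λ z → ((1ℤ - z + + r0) * Cℤ p r0 + Cℤ-prev p r0) * Cℤ q r1) (classCount≡classSize n 0)) (by-ring′ (1ℤ - + classSize n 0 + + r0) (Cℤ p r0) (Cℤ-prev p r0) (Cℤ q r1))))
      where by-ring : ∀ a b P c s d → a * b - (P * (c * b) + (s - P) * (d * b)) ≡ (a - (P * c + (s - P) * d)) * b
            by-ring = solve-∀
            by-ring′ : ∀ k x y b → (k * x + y) * b ≡ k * (x * b) + y * b
            by-ring′ = solve-∀

  weightedCount-step₁ : ∀ n r0 r1 → n % 2 ≡ 1 → weightedCount (suc n) r0 r1 ≡ (1ℤ - + classSize n 1 + + r1) * weightedCount n r0 r1 + weightedCount-prev₁ n r0 r1
  weightedCount-step₁ n r0 r1 nc = begin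
      weightedCount (suc n) r0 r1
    ≡⟨ weightedSign-recurrence n 1 0 nc (λ ()) (λ x y → Cℤ y r0 * Cℤ x r1) ⟩
      signedPAPSum n (λ u → insertionTransfer (classCount n 1) (λ x y → Cℤ y r0 * Cℤ x r1) (fixedIn 1 u) (fixedIn 0 u))
    ≡⟨ signedPAPSum-cong n (λ u → binomial-step (fixedIn 1 u) (fixedIn 0 u)) ⟩
      signedPAPSum n (λ u → (1ℤ - + classSize n 1 + + r1) * (Cℤ (fixedIn 0 u) r0 * Cℤ (fixedIn 1 u) r1) + Cℤ (fixedIn 0 u) r0 * Cℤ-prev (fixedIn 1 u) r1)
    ≡⟨ signedPAPSum-linear n (1ℤ - + classSize n 1 + + r1) (λ u → Cℤ (fixedIn 0 u) r0 * Cℤ (fixedIn 1 u) r1) (λ u → Cℤ (fixedIn 0 u) r0 * Cℤ-prev (fixedIn 1 u) r1) ⟩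
      (1ℤ - + classSize n 1 + + r1) * weightedCount n r0 r1 + signedPAPSum n (λ u → Cℤ (fixedIn 0 u) r0 * Cℤ-prev (fixedIn 1 u) r1)
    ≡⟨ cong (λ z → (1ℤ - + classSize n 1 + + r1) * weightedCount n r0 r1 + z) (signedPAPSum-prev₁ n r0 r1) ⟩
      (1ℤ - + classSize n 1 + + r1) * weightedCount n r0 r1 + weightedCount-prev₁ n r0 r1 ∎
    where
    open ≡-Reasoning
    binomial-step : ∀ p q → insertionTransfer (classCount n 1) (λ x y → Cℤ y r0 * Cℤ x r1) p q ≡
      (1ℤ - + classSize n 1 + + r1) * (Cℤ q r0 * Cℤ p r1) + Cℤ q r0 * Cℤ-prev p r1
    binomial-step p q = trans (by-ring (Cℤ (suc p) r1) (Cℤ q r0) (+ p) (Cℤ (p ∸ 1) r1) (classCount n 1) (Cℤ p r1))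
             (trans (cong (Cℤ q r0 *_) (Cℤ-insertion-identity p r1 (classCount n 1)))
             (trans (cong (λ z → Cℤ q r0 * ((1ℤ - z + + r1) * Cℤ p r1 + Cℤ-prev p r1)) (classCount≡classSize n 1)) (by-ring′ (1ℤ - + classSize n 1 + + r1) (Cℤ p r1) (Cℤ-prev p r1) (Cℤ q r0))))
      where by-ring : ∀ a b P c s d → b * a - (P * (b * c) + (s - P) * (b * d)) ≡ b * (a - (P * c + (s - P) * d))
            by-ring = solve-∀
            by-ring′ : ∀ k x y b → b * (k * x + y) ≡ k * (b * x) + b * y
            by-ring′ = solve-∀

  classSize-suc-even : ∀ n → n % 2 ≡ 0 → classSize (suc n) 0 ≡ suc (classSize n 0) × classSize (suc n) 1 ≡ classSize n 1
  classSize-suc-even n n%2≡0 rewrite n%2≡0 = ℕP.+-comm (classSize n 0) 1 , ℕP.+-identityʳ (classSize n 1)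

  classSize-suc-odd : ∀ n → n % 2 ≡ 1 → classSize (suc n) 0 ≡ classSize n 0 × classSize (suc n) 1 ≡ suc (classSize n 1)
  classSize-suc-odd n n%2≡1 rewrite n%2≡1 = ℕP.+-identityʳ (classSize n 0) , ℕP.+-comm (classSize n 1) 1

  -- Both sides obey the same recurrence in n: the new point n only affects the statistics of its own parity class.
  weightedCount≡Φ : ∀ n r0 r1 → weightedCount n r0 r1 ≡ Φ (classSize n 0) r0 * Φ (classSize n 1) r1
  weightedCount≡Φ zero zero zero = refl
  weightedCount≡Φ zero zero (suc r1) = refl
  weightedCount≡Φ zero (suc r0) zero = refl
  weightedCount≡Φ zero (suc r0) (suc r1) = refl
  weightedCount≡Φ (suc n) r0 r1 with parity n
  ... | inj₁ (nc , _) = begin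
      weightedCount (suc n) r0 r1
    ≡⟨ weightedCount-step₀ n r0 r1 nc ⟩
      (1ℤ - + classSize n 0 + + r0) * weightedCount n r0 r1 + weightedCount-prev₀ n r0 r1
    ≡⟨ cong₂ _+_ (cong ((1ℤ - + classSize n 0 + + r0) *_) (weightedCount≡Φ n r0 r1)) (prev≡Φ-prev r0) ⟩
      (1ℤ - + classSize n 0 + + r0) * (Φ (classSize n 0) r0 * Φ (classSize n 1) r1) + Φ-prev (classSize n 0) r0 * Φ (classSize n 1) r1
    ≡⟨ by-ring (1ℤ - + classSize n 0 + + r0) (Φ (classSize n 0) r0) (Φ (classSize n 1) r1) (Φ-prev (classSize n 0) r0) ⟩
      ((1ℤ - + classSize n 0 + + r0) * Φ (classSize n 0) r0 + Φ-prev (classSize n 0) r0) * Φ (classSize n 1) r1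
    ≡⟨ cong (_* Φ (classSize n 1) r1) (sym (Φ-recurrence (classSize n 0) r0)) ⟩
      Φ (suc (classSize n 0)) r0 * Φ (classSize n 1) r1
    ≡⟨ sym (cong₂ (λ a b → Φ a r0 * Φ b r1) (proj₁ (classSize-suc-even n nc)) (proj₂ (classSize-suc-even n nc))) ⟩
      Φ (classSize (suc n) 0) r0 * Φ (classSize (suc n) 1) r1 ∎
    where
    open ≡-Reasoning
    prev≡Φ-prev : ∀ r0 → weightedCount-prev₀ n r0 r1 ≡ Φ-prev (classSize n 0) r0 * Φ (classSize n 1) r1
    prev≡Φ-prev zero = refl
    prev≡Φ-prev (suc r0) = weightedCount≡Φ n r0 r1
    by-ring : ∀ k x y z → k * (x * y) + z * y ≡ (k * x + z) * y
    by-ring = solve-∀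
  ... | inj₂ (nc , _) = begin
      weightedCount (suc n) r0 r1
    ≡⟨ weightedCount-step₁ n r0 r1 nc ⟩
      (1ℤ - + classSize n 1 + + r1) * weightedCount n r0 r1 + weightedCount-prev₁ n r0 r1
    ≡⟨ cong₂ _+_ (cong ((1ℤ - + classSize n 1 + + r1) *_) (weightedCount≡Φ n r0 r1)) (prev≡Φ-prev r1) ⟩
      (1ℤ - + classSize n 1 + + r1) * (Φ (classSize n 0) r0 * Φ (classSize n 1) r1) + Φ (classSize n 0) r0 * Φ-prev (classSize n 1) r1
    ≡⟨ by-ring (1ℤ - + classSize n 1 + + r1) (Φ (classSize n 0) r0) (Φ (classSize n 1) r1) (Φ-prev (classSize n 1) r1) ⟩
      Φ (classSize n 0) r0 * ((1ℤ - + classSize n 1 + + r1) * Φ (classSize n 1) r1 + Φ-prev (classSize n 1) r1)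
    ≡⟨ cong (Φ (classSize n 0) r0 *_) (sym (Φ-recurrence (classSize n 1) r1)) ⟩
      Φ (classSize n 0) r0 * Φ (suc (classSize n 1)) r1
    ≡⟨ sym (cong₂ (λ a b → Φ a r0 * Φ b r1) (proj₁ (classSize-suc-odd n nc)) (proj₂ (classSize-suc-odd n nc))) ⟩
      Φ (classSize (suc n) 0) r0 * Φ (classSize (suc n) 1) r1 ∎
    where
    open ≡-Reasoning
    prev≡Φ-prev : ∀ r1 → weightedCount-prev₁ n r0 r1 ≡ Φ (classSize n 0) r0 * Φ-prev (classSize n 1) r1
    prev≡Φ-prev zero = sym (*-zeroʳ (Φ (classSize n 0) r0))
    prev≡Φ-prev (suc r1) = weightedCount≡Φ n r0 r1
    by-ring : ∀ k x y z → k * (x * y) + x * z ≡ x * (k * y + z)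
    by-ring = solve-∀


module SignedDerangements where

  open import Data.Nat as ℕ using (ℕ; _%_; _≤_)
  open import Data.Integer as ℤ using (+_; _+_; _*_; -_; _-_)
  open import Data.Integer.Properties hiding (_≟_)
  open import Data.Integer.Tactic.RingSolver
  open import Data.Fin as Fin using (Fin; toℕ)
  open import Data.Fin.Properties using (_≟_)
  open import Data.Vec using (Vec; lookup)
  open import Data.List using (List; []; _∷_; allFin; filter; length)
  open import Data.List.Membership.Propositional using (_∈_)
  open import Data.List.Membership.Propositional.Properties using (∈-filter⁺; ∈-allFin)
  open import Data.Empty using (⊥)
  open import Data.Product using (_×_; _,_)
  open import Data.Sum using (inj₁; inj₂)
  open import Relation.Binary.PropositionalEquality
  open import Relation.Nullary
  open import Relation.Nullary.Decidable using (_×-dec_)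
  open IndicatorSums
  open InsertionStatistics
  open InsertionRecurrence
  open Binomial
  open WeightedSignedCount

  ⟦even⟧-⟦odd⟧ : ∀ {a b c d} {A : Set a} {B' : Set b} {C : Set c} {D : Set d} (x : Dec A) (y : Dec B') (z : Dec C) (w : Dec D) →
    ⟦ (x ×-dec (y ×-dec z)) ×-dec w ⟧ - ⟦ (x ×-dec (y ×-dec z)) ×-dec ¬? w ⟧ ≡ ⟦ x ⟧ * (⟦ y ⟧ * (sign w * ⟦ z ⟧))
  ⟦even⟧-⟦odd⟧ (yes _) (yes _) (yes _) (yes _) = refl
  ⟦even⟧-⟦odd⟧ (yes _) (yes _) (yes _) (no _) = refl
  ⟦even⟧-⟦odd⟧ (yes _) (yes _) (no _) (yes _) = refl
  ⟦even⟧-⟦odd⟧ (yes _) (yes _) (no _) (no _) = refl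
  ⟦even⟧-⟦odd⟧ (yes _) (no _) z (yes _) = refl
  ⟦even⟧-⟦odd⟧ (yes _) (no _) z (no _) = refl
  ⟦even⟧-⟦odd⟧ (no _) y z (yes _) = refl
  ⟦even⟧-⟦odd⟧ (no _) y z (no _) = refl

  derangement⇒fixedIn≡0 : ∀ {n} (c : ℕ) (v : Vec (Fin n) n) → Derangement v → fixedIn c v ≡ 0
  derangement⇒fixedIn≡0 {n} c v d = +-injective (trans (fixedIn≡∑ c v) (∑-zero (allFin n) _ (λ i → ⟦⟧-no (fixedIn? c v i) (λ { (_ , e) → d i e }))))

  fixed⇒fixedIn≢0 : ∀ {n} (c : ℕ) (v : Vec (Fin n) n) (i : Fin n) → toℕ i % 2 ≡ c → lookup v i ≡ i → fixedIn c v ≢ 0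
  fixed⇒fixedIn≢0 {n} c v i ci e z = by-cases (filter (fixedIn? c v) (allFin n)) z (∈-filter⁺ (fixedIn? c v) (∈-allFin i) (ci , e))
    where by-cases : ∀ (xs : List (Fin n)) → length xs ≡ 0 → i ∈ xs → ⊥
          by-cases [] _ ()
          by-cases (_ ∷ _) ()

  ⟦derangement⟧ : ∀ {n} (v : Vec (Fin n) n) → ⟦ derangement? v ⟧ ≡ ⟦ fixedIn 0 v ℕ.≟ 0 ⟧ * ⟦ fixedIn 1 v ℕ.≟ 0 ⟧
  ⟦derangement⟧ v = ⟦⟧-× (derangement? v) (fixedIn 0 v ℕ.≟ 0) (fixedIn 1 v ℕ.≟ 0) (λ d → derangement⇒fixedIn≡0 0 v d , derangement⇒fixedIn≡0 1 v d) g
    where g : fixedIn 0 v ≡ 0 → fixedIn 1 v ≡ 0 → Derangement v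
          g z0 z1 i e with parity (toℕ i)
          ... | inj₁ (c , _) = fixed⇒fixedIn≢0 0 v i c e z0
          ... | inj₂ (c , _) = fixed⇒fixedIn≢0 1 v i c e z1

  fixedIn≤ : ∀ {n} c (v : Vec (Fin n) n) → fixedIn c v ≤ n
  fixedIn≤ c v = length-filter-allFin≤ (fixedIn? c v)

  𝔣≡signedPAPSum : ∀ n → 𝔣 n ≡ signedPAPSum n (λ v → ⟦ derangement? v ⟧)
  𝔣≡signedPAPSum n = begin
      + dE n - + dO n
    ≡⟨ cong₂ _-_ (length-filter≡∑ (evenPAD? {n}) W) (length-filter≡∑ (oddPAD? {n}) W) ⟩
      ∑ W (λ v → ⟦ evenPAD? v ⟧) - ∑ W (λ v → ⟦ oddPAD? v ⟧)
    ≡⟨ cong (λ z → ∑ W (λ v → ⟦ evenPAD? v ⟧) + z) (sym (∑-neg W (λ v → ⟦ oddPAD? v ⟧))) ⟩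
      ∑ W (λ v → ⟦ evenPAD? v ⟧) + ∑ W (λ v → - ⟦ oddPAD? v ⟧)
    ≡⟨ sym (∑-+ W _ _) ⟩
      ∑ W (λ v → ⟦ evenPAD? v ⟧ - ⟦ oddPAD? v ⟧)
    ≡⟨ ∑-cong W (λ v → ⟦even⟧-⟦odd⟧ (isPerm? v) (parityAlt? v) (derangement? v) (isEven? v)) ⟩
      signedPAPSum n (λ v → ⟦ derangement? v ⟧) ∎
    where
    open ≡-Reasoning
    W = allWords n n

  -- Inclusion–exclusion over the fixed points of each parity class.
  ⟦derangement⟧≡∑∑ : ∀ {n} (v : Vec (Fin n) n) → ⟦ derangement? v ⟧ ≡
    ∑ (range n) (λ r0 → ∑ (range n) (λ r1 → (neg1^ r0 * neg1^ r1) * (Cℤ (fixedIn 0 v) r0 * Cℤ (fixedIn 1 v) r1)))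
  ⟦derangement⟧≡∑∑ {n} v = begin
      ⟦ derangement? v ⟧
    ≡⟨ ⟦derangement⟧ v ⟩
      ⟦ fixedIn 0 v ℕ.≟ 0 ⟧ * ⟦ fixedIn 1 v ℕ.≟ 0 ⟧
    ≡⟨ sym (cong₂ _*_ (∑-alternating-choose (fixedIn 0 v) n (fixedIn≤ 0 v)) (∑-alternating-choose (fixedIn 1 v) n (fixedIn≤ 1 v))) ⟩
      ∑ R (λ r0 → neg1^ r0 * Cℤ (fixedIn 0 v) r0) * ∑ R (λ r1 → neg1^ r1 * Cℤ (fixedIn 1 v) r1)
    ≡⟨ ∑*∑ R R (λ r0 → neg1^ r0 * Cℤ (fixedIn 0 v) r0) (λ r1 → neg1^ r1 * Cℤ (fixedIn 1 v) r1) ⟩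
      ∑ R (λ r0 → ∑ R (λ r1 → (neg1^ r0 * Cℤ (fixedIn 0 v) r0) * (neg1^ r1 * Cℤ (fixedIn 1 v) r1)))
    ≡⟨ ∑-cong R (λ r0 → ∑-cong R (λ r1 → by-ring (neg1^ r0) (Cℤ (fixedIn 0 v) r0) (neg1^ r1) (Cℤ (fixedIn 1 v) r1))) ⟩
      ∑ R (λ r0 → ∑ R (λ r1 → (neg1^ r0 * neg1^ r1) * (Cℤ (fixedIn 0 v) r0 * Cℤ (fixedIn 1 v) r1))) ∎
    where
    open ≡-Reasoning
    R = range n
    by-ring : ∀ x y z w → (x * y) * (z * w) ≡ (x * z) * (y * w)
    by-ring = solve-∀

  𝔣≡ψψ : ∀ n → 𝔣 n ≡ ψ (classSize n 0) * ψ (classSize n 1)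
  𝔣≡ψψ n = begin
      𝔣 n
    ≡⟨ 𝔣≡signedPAPSum n ⟩
      signedPAPSum n (λ v → ⟦ derangement? v ⟧)
    ≡⟨ signedPAPSum-cong n ⟦derangement⟧≡∑∑ ⟩
      signedPAPSum n (λ v → ∑ R (λ r0 → ∑ R (λ r1 → (neg1^ r0 * neg1^ r1) * (Cℤ (fixedIn 0 v) r0 * Cℤ (fixedIn 1 v) r1))))
    ≡⟨ signedPAPSum-∑ n R _ ⟩
      ∑ R (λ r0 → signedPAPSum n (λ v → ∑ R (λ r1 → (neg1^ r0 * neg1^ r1) * (Cℤ (fixedIn 0 v) r0 * Cℤ (fixedIn 1 v) r1))))
    ≡⟨ ∑-cong R (λ r0 → trans (signedPAPSum-∑ n R _) (∑-cong R (λ r1 → signedPAPSum-* n (neg1^ r0 * neg1^ r1) _))) ⟩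
      ∑ R (λ r0 → ∑ R (λ r1 → (neg1^ r0 * neg1^ r1) * weightedCount n r0 r1))
    ≡⟨ ∑-cong R (λ r0 → ∑-cong R (λ r1 → cong ((neg1^ r0 * neg1^ r1) *_) (weightedCount≡Φ n r0 r1))) ⟩
      ∑ R (λ r0 → ∑ R (λ r1 → (neg1^ r0 * neg1^ r1) * (Φ ca r0 * Φ cb r1)))
    ≡⟨ ∑-cong R (λ r0 → ∑-cong R (λ r1 → by-ring (neg1^ r0) (neg1^ r1) (Φ ca r0) (Φ cb r1))) ⟩
      ∑ R (λ r0 → ∑ R (λ r1 → (neg1^ r0 * Φ ca r0) * (neg1^ r1 * Φ cb r1)))
    ≡⟨ sym (∑*∑ R R (λ r0 → neg1^ r0 * Φ ca r0) (λ r1 → neg1^ r1 * Φ cb r1)) ⟩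
      ∑ R (λ r0 → neg1^ r0 * Φ ca r0) * ∑ R (λ r1 → neg1^ r1 * Φ cb r1)
    ≡⟨ cong₂ _*_ (∑-alternating-Φ ca n (classSize≤ n 0)) (∑-alternating-Φ cb n (classSize≤ n 1)) ⟩
      ψ ca * ψ cb ∎
    where
    open ≡-Reasoning
    R = range n
    ca = classSize n 0
    cb = classSize n 1
    by-ring : ∀ x y z w → (x * y) * (z * w) ≡ (x * z) * (y * w)
    by-ring = solve-∀


module RationalEGF where

  open import Data.Nat as ℕ using (ℕ; zero; suc; _∸_)
  open import Data.Nat.Coprimality using (Coprime; 1-coprimeTo)
  import Data.Nat.Coprimality as Cop
  open import Data.Integer as ℤ using (ℤ; +_; -[1+_]; 0ℤ; 1ℤ)
  import Data.Integer.Properties as ℤP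
  open import Data.Rational as ℚ using (ℚ; mkℚ; _/_; 0ℚ; 1ℚ)
  import Data.Rational.Properties as ℚP
  open import Relation.Binary.PropositionalEquality
  open import Data.List using (List; []; _∷_; map; foldr; upTo)
  open import Data.Nat.Combinatorics using (_C_)
  open IndicatorSums using (∑)
  open Binomial using (neg1^)

  ι : ℤ → ℚ
  ι = ℤtoℚ

  coprime-1 : ∀ m → Coprime m 1
  coprime-1 m = Cop.sym (1-coprimeTo m)

  ι≡mkℚ : ∀ z → ι z ≡ mkℚ z 0 (coprime-1 ℤ.∣ z ∣)
  ι≡mkℚ (+ m) = ℚP.normalize-coprime (coprime-1 m)
  ι≡mkℚ -[1+ m ] = cong ℚ.-_ (ℚP.normalize-coprime (coprime-1 (suc m)))

  ι-+ : ∀ x y → ι x ℚ.+ ι y ≡ ι (x ℤ.+ y)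
  ι-+ x y rewrite ι≡mkℚ x | ι≡mkℚ y = cong (λ z → z / 1) (cong₂ ℤ._+_ (ℤP.*-identityʳ x) (ℤP.*-identityʳ y))

  ι-* : ∀ x y → ι x ℚ.* ι y ≡ ι (x ℤ.* y)
  ι-* x y rewrite ι≡mkℚ x | ι≡mkℚ y = refl

  ι-neg : ∀ x → ℚ.- ι x ≡ ι (ℤ.- x)
  ι-neg x rewrite ι≡mkℚ x | ι≡mkℚ (ℤ.- x) = by-cases x
    where by-cases : ∀ x → ℚ.- mkℚ x 0 (coprime-1 ℤ.∣ x ∣) ≡ mkℚ (ℤ.- x) 0 (coprime-1 ℤ.∣ ℤ.- x ∣)
          by-cases (+ zero) = refl
          by-cases (+ suc m) = refl
          by-cases -[1+ m ] = refl

  rhsPoly : List ℚ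
  rhsPoly = ℤtoℚ (+ 7) ∷ ℤtoℚ (+ 6) ∷ ℤtoℚ (+ 2) ∷ []

  expNegX≡ι : ∀ k → expNegX k ≡ ι (neg1^ k)
  expNegX≡ι zero = refl
  expNegX≡ι (suc k) = trans (cong ℚ.-_ (expNegX≡ι k)) (ι-neg (neg1^ k))

  -- EGF coefficients m! · cₘ of 7 + 6x + 2x².
  rhsPolyℤ : ℕ → ℤ
  rhsPolyℤ 0 = + 7
  rhsPolyℤ 1 = + 6
  rhsPolyℤ 2 = + 4
  rhsPolyℤ (suc (suc (suc _))) = 0ℤ

  poly≡ι : ∀ m → poly rhsPoly m ≡ ι (rhsPolyℤ m)
  poly≡ι 0 = refl
  poly≡ι 1 = refl
  poly≡ι 2 = refl
  poly≡ι (suc (suc (suc m))) = trans (ι-* (+ (suc (suc (suc m)) ℕ.!)) 0ℤ) (cong ι (ℤP.*-zeroʳ (+ (suc (suc (suc m)) ℕ.!))))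

  foldr-+≡ι∑ : ∀ (xs : List ℕ) (g : ℕ → ℚ) (h : ℕ → ℤ) → (∀ k → g k ≡ ι (h k)) → foldr ℚ._+_ 0ℚ (map g xs) ≡ ι (∑ xs h)
  foldr-+≡ι∑ [] g h eq = refl
  foldr-+≡ι∑ (x ∷ xs) g h eq = trans (cong₂ ℚ._+_ (eq x) (foldr-+≡ι∑ xs g h eq)) (ι-+ (h x) (∑ xs h))

  convolution : ℕ → ℤ
  convolution n = ∑ (upTo (suc n)) (λ k → + (n C k) ℤ.* (neg1^ k ℤ.* rhsPolyℤ (n ∸ k)))

  ⊛≡ι : ∀ n → (expNegX ⊛ poly rhsPoly) n ≡ ι (convolution n)
  ⊛≡ι n = foldr-+≡ι∑ (upTo (suc n)) _ (λ k → + (n C k) ℤ.* (neg1^ k ℤ.* rhsPolyℤ (n ∸ k)))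
    (λ k → trans (cong₂ (λ x y → ℕtoℚ (n C k) ℚ.* (x ℚ.* y)) (expNegX≡ι k) (poly≡ι (n ∸ k)))
            (trans (cong (ℕtoℚ (n C k) ℚ.*_) (ι-* (neg1^ k) (rhsPolyℤ (n ∸ k)))) (ι-* (+ (n C k)) (neg1^ k ℤ.* rhsPolyℤ (n ∸ k)))))

  ⅛ : ℚ
  ⅛ = + 1 / 8

  ι≡rhs : ∀ n (f : ℤ) → + 8 ℤ.* f ≡ 1ℤ ℤ.+ convolution n → ι f ≡ rhs n
  ι≡rhs n f eq = sym (begin
      ⅛ ℚ.* 1ℚ ℚ.+ ⅛ ℚ.* (expNegX ⊛ poly rhsPoly) n
    ≡⟨ cong (λ z → ⅛ ℚ.* 1ℚ ℚ.+ ⅛ ℚ.* z) (⊛≡ι n) ⟩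
      ⅛ ℚ.* ι 1ℤ ℚ.+ ⅛ ℚ.* ι (convolution n)
    ≡⟨ sym (ℚP.*-distribˡ-+ ⅛ (ι 1ℤ) (ι (convolution n))) ⟩
      ⅛ ℚ.* (ι 1ℤ ℚ.+ ι (convolution n))
    ≡⟨ cong (⅛ ℚ.*_) (trans (ι-+ 1ℤ (convolution n)) (cong ι (sym eq))) ⟩
      ⅛ ℚ.* ι (+ 8 ℤ.* f)
    ≡⟨ cong (⅛ ℚ.*_) (sym (ι-* (+ 8) f)) ⟩
      ⅛ ℚ.* (ι (+ 8) ℚ.* ι f)
    ≡⟨ sym (ℚP.*-assoc ⅛ (ι (+ 8)) (ι f)) ⟩
      (⅛ ℚ.* ι (+ 8)) ℚ.* ι f
    ≡⟨ ℚP.*-identityˡ (ι f) ⟩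
      ι f ∎)
    where open ≡-Reasoning


module ClosedForm where

  open import Data.Nat as ℕ using (ℕ; zero; suc; _∸_; _%_; _<_; z≤n; s≤s)
  import Data.Nat.Properties as ℕP
  open import Data.Nat.Combinatorics using (_C_; nCn≡1; nC1≡n; nCk≡nC[n∸k]; nCk+nC[k+1]≡[n+1]C[k+1])
  open import Data.Integer as ℤ using (ℤ; +_; 0ℤ; 1ℤ; _+_; _*_; -_; _-_)
  open import Data.Integer.Properties hiding (_≟_)
  open import Data.Integer.Tactic.RingSolver
  open import Data.List using (applyUpTo; upTo)
  open import Data.Product using (∃; _×_; _,_; proj₁; proj₂)
  open import Data.Sum using (_⊎_; inj₁; inj₂)
  open import Relation.Binary.PropositionalEquality
  open IndicatorSums using (∑)
  open Binomial using (neg1^; ψ)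
  open WeightedSignedCount using (classSize; classSize-suc-even; classSize-suc-odd)
  open InsertionStatistics using (parity; %2-step)
  open RationalEGF using (convolution; rhsPolyℤ)

  ∑-applyUpTo-snoc : ∀ (g : ℕ → ℕ) N (f : ℕ → ℤ) → ∑ (applyUpTo g (suc N)) f ≡ ∑ (applyUpTo g N) f + f (g N)
  ∑-applyUpTo-snoc g zero f = trans (+-identityʳ (f (g 0))) (sym (+-identityˡ (f (g 0))))
  ∑-applyUpTo-snoc g (suc N) f = trans (cong (λ z → f (g 0) + z) (∑-applyUpTo-snoc (λ x → g (suc x)) N f)) (sym (+-assoc (f (g 0)) _ _))

  ∑-applyUpTo-zero : ∀ (g : ℕ → ℕ) m (f : ℕ → ℤ) → (∀ k → k < m → f (g k) ≡ 0ℤ) → ∑ (applyUpTo g m) f ≡ 0ℤ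
  ∑-applyUpTo-zero g zero f h = refl
  ∑-applyUpTo-zero g (suc m) f h = cong₂ _+_ (h 0 (s≤s z≤n)) (∑-applyUpTo-zero (λ x → g (suc x)) m f (λ k k<m → h (suc k) (s≤s k<m)))

  2+m∸k≡3+ : ∀ m k → k < m → ∃ λ j → suc (suc m) ∸ k ≡ suc (suc (suc j))
  2+m∸k≡3+ (suc m) zero _ = m , refl
  2+m∸k≡3+ (suc m) (suc k) (s≤s k<m) = 2+m∸k≡3+ m k k<m

  2+m∸m≡2 : ∀ m → suc (suc m) ∸ m ≡ 2
  2+m∸m≡2 zero = refl
  2+m∸m≡2 (suc m) = 2+m∸m≡2 m

  1+m∸m≡1 : ∀ m → suc m ∸ m ≡ 1
  1+m∸m≡1 zero = refl
  1+m∸m≡1 (suc m) = 1+m∸m≡1 m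

  2*[nC2]≡n*[n∸1] : ∀ m → + 2 * + (suc (suc m) C 2) ≡ + suc (suc m) * + suc m
  2*[nC2]≡n*[n∸1] zero = refl
  2*[nC2]≡n*[n∸1] (suc m) = begin
      + 2 * + (suc (suc (suc m)) C 2)
    ≡⟨ cong (λ z → + 2 * + z) (sym (nCk+nC[k+1]≡[n+1]C[k+1] (suc (suc m)) 1)) ⟩
      + 2 * (+ (suc (suc m) C 1) + + (suc (suc m) C 2))
    ≡⟨ *-distribˡ-+ (+ 2) (+ (suc (suc m) C 1)) (+ (suc (suc m) C 2)) ⟩
      + 2 * + (suc (suc m) C 1) + + 2 * + (suc (suc m) C 2)
    ≡⟨ cong₂ (λ x y → + 2 * + x + y) (nC1≡n (suc (suc m))) (2*[nC2]≡n*[n∸1] m) ⟩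
      + 2 * + suc (suc m) + + suc (suc m) * + suc m
    ≡⟨ by-ring (+ m) ⟩
      + suc (suc (suc m)) * + suc (suc m) ∎
    where
    open ≡-Reasoning
    by-ring : ∀ m → (1ℤ + 1ℤ) * (1ℤ + (1ℤ + m)) + (1ℤ + (1ℤ + m)) * (1ℤ + m) ≡ (1ℤ + (1ℤ + (1ℤ + m))) * (1ℤ + (1ℤ + m))
    by-ring = solve-∀

  -- Only the last three terms of the binomial convolution meet a nonzero coefficient of 7 + 6x + 2x².
  convolution-2+ : ∀ m → convolution (suc (suc m)) ≡ neg1^ m * (+ 2 * (+ 2 * + (suc (suc m) C 2)) - + 6 * + suc (suc m) + + 7)
  convolution-2+ m = begin
      ∑ (upTo (suc (suc (suc m)))) F
    ≡⟨ ∑-applyUpTo-snoc (λ x → x) (suc (suc m)) F ⟩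
      ∑ (upTo (suc (suc m))) F + F (suc (suc m))
    ≡⟨ cong (_+ F (suc (suc m))) (∑-applyUpTo-snoc (λ x → x) (suc m) F) ⟩
      ∑ (upTo (suc m)) F + F (suc m) + F (suc (suc m))
    ≡⟨ cong (λ z → z + F (suc m) + F (suc (suc m))) (∑-applyUpTo-snoc (λ x → x) m F) ⟩
      ∑ (upTo m) F + F m + F (suc m) + F (suc (suc m))
    ≡⟨ cong (λ z → z + F m + F (suc m) + F (suc (suc m))) (∑-applyUpTo-zero (λ x → x) m F vanishing) ⟩
      0ℤ + F m + F (suc m) + F (suc (suc m))
    ≡⟨ cong₂ (λ x y → 0ℤ + x + y + F (suc (suc m))) F-m F-1+m ⟩
      0ℤ + + (n C 2) * (neg1^ m * + 4) + + n * (- neg1^ m * + 6) + F (suc (suc m))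
    ≡⟨ cong (λ z → 0ℤ + + (n C 2) * (neg1^ m * + 4) + + n * (- neg1^ m * + 6) + z) F-2+m ⟩
      0ℤ + + (n C 2) * (neg1^ m * + 4) + + n * (- neg1^ m * + 6) + neg1^ m * + 7
    ≡⟨ by-ring (+ (n C 2)) (neg1^ m) (+ n) ⟩
      neg1^ m * (+ 2 * (+ 2 * + (n C 2)) - + 6 * + n + + 7) ∎
    where
    open ≡-Reasoning
    n = suc (suc m)
    F : ℕ → ℤ
    F k = + (n C k) * (neg1^ k * rhsPolyℤ (n ∸ k))
    vanishing : ∀ k → k < m → F k ≡ 0ℤ
    vanishing k k<m with 2+m∸k≡3+ m k k<m
    ... | j , eq = trans (cong (λ z → + (n C k) * (neg1^ k * rhsPolyℤ z)) eq)
                         (trans (cong (+ (n C k) *_) (*-zeroʳ (neg1^ k))) (*-zeroʳ (+ (n C k))))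
    F-m : F m ≡ + (n C 2) * (neg1^ m * + 4)
    F-m = cong₂ (λ c z → + c * (neg1^ m * rhsPolyℤ z))
            (trans (nCk≡nC[n∸k] (ℕP.m≤n+m m 2)) (cong (n C_) (2+m∸m≡2 m))) (2+m∸m≡2 m)
    F-1+m : F (suc m) ≡ + n * (- neg1^ m * + 6)
    F-1+m = cong₂ (λ c z → + c * (- neg1^ m * rhsPolyℤ z))
              (trans (nCk≡nC[n∸k] (ℕP.n≤1+n (suc m))) (trans (cong (n C_) (1+m∸m≡1 (suc m))) (nC1≡n n))) (1+m∸m≡1 (suc m))
    F-2+m : F (suc (suc m)) ≡ neg1^ m * + 7
    F-2+m = trans (cong₂ (λ c z → + c * (- - neg1^ m * rhsPolyℤ z)) (nCn≡1 n) (ℕP.n∸n≡0 n))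
                  (trans (*-identityˡ _) (cong (_* + 7) (neg-involutive (neg1^ m))))
    by-ring : ∀ c x s → 0ℤ + c * (x * + 4) + s * (- x * + 6) + x * + 7 ≡ x * (+ 2 * (+ 2 * c) - + 6 * s + + 7)
    by-ring = solve-∀

  quadratic : ℤ → ℤ
  quadratic N = + 2 * (N * N) - + 8 * N + + 7

  convolution≡ : ∀ n → convolution n ≡ neg1^ n * quadratic (+ n)
  convolution≡ zero = refl
  convolution≡ (suc zero) = refl
  convolution≡ (suc (suc m)) = begin
      convolution (suc (suc m))
    ≡⟨ convolution-2+ m ⟩
      neg1^ m * (+ 2 * (+ 2 * + (suc (suc m) C 2)) - + 6 * + suc (suc m) + + 7)
    ≡⟨ cong (λ z → neg1^ m * (+ 2 * z - + 6 * + suc (suc m) + + 7)) (2*[nC2]≡n*[n∸1] m) ⟩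
      neg1^ m * (+ 2 * ((1ℤ + (1ℤ + + m)) * (1ℤ + + m)) - + 6 * (1ℤ + (1ℤ + + m)) + + 7)
    ≡⟨ by-ring (neg1^ m) (+ m) ⟩
      - - neg1^ m * quadratic (1ℤ + (1ℤ + + m)) ∎
    where
    open ≡-Reasoning
    by-ring : ∀ x m → x * (+ 2 * ((1ℤ + (1ℤ + m)) * (1ℤ + m)) - + 6 * (1ℤ + (1ℤ + m)) + + 7) ≡ - - x * (+ 2 * ((1ℤ + (1ℤ + m)) * (1ℤ + (1ℤ + m))) - + 8 * (1ℤ + (1ℤ + m)) + + 7)
    by-ring = solve-∀

  ψ-closed : ∀ s → ψ s ≡ - neg1^ s * (+ s - 1ℤ)
  ψ-closed zero = refl
  ψ-closed (suc s) = by-ring (neg1^ s) (+ s)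
    where
    by-ring : ∀ x s → x * s ≡ - - x * ((1ℤ + s) - 1ℤ)
    by-ring = solve-∀

  neg1^-square : ∀ k → neg1^ k * neg1^ k ≡ 1ℤ
  neg1^-square zero = refl
  neg1^-square (suc k) = trans (by-ring (neg1^ k)) (neg1^-square k)
    where
    by-ring : ∀ x → - x * - x ≡ x * x
    by-ring = solve-∀

  suc+suc : ∀ k → suc k ℕ.+ suc k ≡ suc (suc (k ℕ.+ k))
  suc+suc k = cong suc (ℕP.+-suc k k)

  neg1^-even : ∀ k → neg1^ (k ℕ.+ k) ≡ 1ℤ
  neg1^-even zero = refl
  neg1^-even (suc k) = trans (cong neg1^ (suc+suc k)) (trans (neg-involutive (neg1^ (k ℕ.+ k))) (neg1^-even k))

  8*ψ[k]*ψ[k] : ∀ k → + 8 * (ψ k * ψ k) ≡ 1ℤ + neg1^ (k ℕ.+ k) * quadratic (+ (k ℕ.+ k))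
  8*ψ[k]*ψ[k] k = begin
      + 8 * (ψ k * ψ k)
    ≡⟨ cong (λ z → + 8 * (z * z)) (ψ-closed k) ⟩
      + 8 * ((- neg1^ k * (+ k - 1ℤ)) * (- neg1^ k * (+ k - 1ℤ)))
    ≡⟨ by-ring (neg1^ k) (+ k) ⟩
      (neg1^ k * neg1^ k) * (+ 8 * ((+ k - 1ℤ) * (+ k - 1ℤ)))
    ≡⟨ cong (_* (+ 8 * ((+ k - 1ℤ) * (+ k - 1ℤ)))) (neg1^-square k) ⟩
      1ℤ * (+ 8 * ((+ k - 1ℤ) * (+ k - 1ℤ)))
    ≡⟨ by-ring′ (+ k) ⟩
      1ℤ + 1ℤ * quadratic (+ k + + k)
    ≡⟨ cong₂ (λ x z → 1ℤ + x * quadratic z) (sym (neg1^-even k)) (sym (pos-+ k k)) ⟩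
      1ℤ + neg1^ (k ℕ.+ k) * quadratic (+ (k ℕ.+ k)) ∎
    where
    open ≡-Reasoning
    by-ring : ∀ x k → + 8 * ((- x * (k - 1ℤ)) * (- x * (k - 1ℤ))) ≡ (x * x) * (+ 8 * ((k - 1ℤ) * (k - 1ℤ)))
    by-ring = solve-∀
    by-ring′ : ∀ k → 1ℤ * (+ 8 * ((k - 1ℤ) * (k - 1ℤ))) ≡ 1ℤ + 1ℤ * (+ 2 * ((k + k) * (k + k)) - + 8 * (k + k) + + 7)
    by-ring′ = solve-∀

  8*ψ[1+k]*ψ[k] : ∀ k → + 8 * (ψ (suc k) * ψ k) ≡ 1ℤ + neg1^ (suc (k ℕ.+ k)) * quadratic (+ suc (k ℕ.+ k))
  8*ψ[1+k]*ψ[k] k = begin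
      + 8 * (ψ (suc k) * ψ k)
    ≡⟨ cong (λ z → + 8 * (ψ (suc k) * z)) (ψ-closed k) ⟩
      + 8 * ((neg1^ k * + k) * (- neg1^ k * (+ k - 1ℤ)))
    ≡⟨ by-ring (neg1^ k) (+ k) ⟩
      (neg1^ k * neg1^ k) * (- + 8 * (+ k * (+ k - 1ℤ)))
    ≡⟨ cong (_* (- + 8 * (+ k * (+ k - 1ℤ)))) (neg1^-square k) ⟩
      1ℤ * (- + 8 * (+ k * (+ k - 1ℤ)))
    ≡⟨ by-ring′ (+ k) ⟩
      1ℤ + - 1ℤ * quadratic (1ℤ + (+ k + + k))
    ≡⟨ cong₂ (λ x z → 1ℤ + - x * quadratic (1ℤ + z)) (sym (neg1^-even k)) (sym (pos-+ k k)) ⟩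
      1ℤ + neg1^ (suc (k ℕ.+ k)) * quadratic (+ suc (k ℕ.+ k)) ∎
    where
    open ≡-Reasoning
    by-ring : ∀ x k → + 8 * ((x * k) * (- x * (k - 1ℤ))) ≡ (x * x) * (- + 8 * (k * (k - 1ℤ)))
    by-ring = solve-∀
    by-ring′ : ∀ k → 1ℤ * (- + 8 * (k * (k - 1ℤ))) ≡ 1ℤ + - 1ℤ * (+ 2 * ((1ℤ + (k + k)) * (1ℤ + (k + k))) - + 8 * (1ℤ + (k + k)) + + 7)
    by-ring′ = solve-∀

  even-%2 : ∀ k → (k ℕ.+ k) % 2 ≡ 0
  even-%2 zero = refl
  even-%2 (suc k) = trans (cong (_% 2) (suc+suc k)) (trans (%2-step (k ℕ.+ k)) (even-%2 k))

  odd-%2 : ∀ k → suc (k ℕ.+ k) % 2 ≡ 1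
  odd-%2 k with parity (k ℕ.+ k)
  ... | inj₁ (_ , odd) = odd
  ... | inj₂ (one , _) with trans (sym (even-%2 k)) one
  ... | ()

  classSize-even : ∀ k → classSize (k ℕ.+ k) 0 ≡ k × classSize (k ℕ.+ k) 1 ≡ k
  classSize-even zero = refl , refl
  classSize-even (suc k) = subst (λ n → classSize n 0 ≡ suc k × classSize n 1 ≡ suc k) (sym (suc+suc k))
    (let (a₀ , a₁) = classSize-suc-even (k ℕ.+ k) (even-%2 k)
         (b₀ , b₁) = classSize-suc-odd (suc (k ℕ.+ k)) (odd-%2 k)
         (c₀ , c₁) = classSize-even k
     in trans b₀ (trans a₀ (cong suc c₀)) , trans b₁ (cong suc (trans a₁ c₁)))

  classSize-odd : ∀ k → classSize (suc (k ℕ.+ k)) 0 ≡ suc k × classSize (suc (k ℕ.+ k)) 1 ≡ k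
  classSize-odd k =
    let (a₀ , a₁) = classSize-suc-even (k ℕ.+ k) (even-%2 k)
        (c₀ , c₁) = classSize-even k
    in trans a₀ (cong suc c₀) , trans a₁ c₁

  even-or-odd : ∀ n → ∃ λ k → n ≡ k ℕ.+ k ⊎ n ≡ suc (k ℕ.+ k)
  even-or-odd zero = 0 , inj₁ refl
  even-or-odd (suc n) with even-or-odd n
  ... | k , inj₁ eq = k , inj₂ (cong suc eq)
  ... | k , inj₂ eq = suc k , inj₁ (trans (cong suc eq) (sym (suc+suc k)))

  8*ψψ≡1+convolution : ∀ n → + 8 * (ψ (classSize n 0) * ψ (classSize n 1)) ≡ 1ℤ + convolution n
  8*ψψ≡1+convolution n with even-or-odd n
  ... | k , inj₁ refl = begin
      + 8 * (ψ (classSize (k ℕ.+ k) 0) * ψ (classSize (k ℕ.+ k) 1))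
    ≡⟨ cong₂ (λ a b → + 8 * (ψ a * ψ b)) (proj₁ (classSize-even k)) (proj₂ (classSize-even k)) ⟩
      + 8 * (ψ k * ψ k)
    ≡⟨ 8*ψ[k]*ψ[k] k ⟩
      1ℤ + neg1^ (k ℕ.+ k) * quadratic (+ (k ℕ.+ k))
    ≡⟨ cong (λ z → 1ℤ + z) (sym (convolution≡ (k ℕ.+ k))) ⟩
      1ℤ + convolution (k ℕ.+ k) ∎
    where open ≡-Reasoning
  ... | k , inj₂ refl = begin
      + 8 * (ψ (classSize (suc (k ℕ.+ k)) 0) * ψ (classSize (suc (k ℕ.+ k)) 1))
    ≡⟨ cong₂ (λ a b → + 8 * (ψ a * ψ b)) (proj₁ (classSize-odd k)) (proj₂ (classSize-odd k)) ⟩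
      + 8 * (ψ (suc k) * ψ k)
    ≡⟨ 8*ψ[1+k]*ψ[k] k ⟩
      1ℤ + neg1^ (suc (k ℕ.+ k)) * quadratic (+ suc (k ℕ.+ k))
    ≡⟨ cong (λ z → 1ℤ + z) (sym (convolution≡ (suc (k ℕ.+ k)))) ⟩
      1ℤ + convolution (suc (k ℕ.+ k)) ∎
    where open ≡-Reasoning


open import Data.Integer using (+_; 1ℤ; _+_; _*_)
open import Relation.Binary.PropositionalEquality using (cong; module ≡-Reasoning)
open Binomial using (ψ)
open WeightedSignedCount using (classSize)
open SignedDerangements using (𝔣≡ψψ)
open RationalEGF using (convolution; ι≡rhs)
open ClosedForm using (8*ψψ≡1+convolution)

theorem5 : ∀ (n : ℕ) → egf 𝔣 n ≡ rhs n
theorem5 n = ι≡rhs n (𝔣 n) (begin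
    + 8 * 𝔣 n
  ≡⟨ cong (+ 8 *_) (𝔣≡ψψ n) ⟩
    + 8 * (ψ (classSize n 0) * ψ (classSize n 1))
  ≡⟨ 8*ψψ≡1+convolution n ⟩
    1ℤ + convolution n ∎)
  where open ≡-Reasoning
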